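{- Let $\Phi$ be a finite, reduced, irreducible root system not of type $G_2$, and $\alpha_i$ a short simple root. Let $\alpha\in\Phi^+$ with $\langle\alpha_i,\alpha\rangle=-1$. Then there exist a simple root $\alpha_j$ with $\langle\alpha_i,\alpha_j\rangle=-1$ and $w\in W$ such that $w\alpha_i=\alpha_i$ and $w\alpha_j=\alpha$.
   Context: $\Phi^+$ is the set of positive roots for the simple roots $\alpha_1,\dots,\alpha_r$, $W$ the Weyl group, and $\langle\cdot,\cdot\rangle$ the $W$-invariant inner product normalized so that short roots have squared length $2$ (all roots short if simply laced).
   Formalization: The root system lies in ℚ^n with an inner product given by a rational symmetric positive-definite matrix, rather than in a real vector space. -}

module Defs where

open import Data.Nat as ℕ using (ℕ; zero; suc)
open import Data.Integer as ℤ using (ℤ; +_)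
open import Data.Rational using (ℚ; 0ℚ; 1ℚ; _+_; _*_; _-_; -_; _÷_; _/_; _≤_; _<_; ≢-nonZero)
open import Data.Rational.Properties using (_≟_)
open import Data.Fin using (Fin; zero; suc)
open import Data.Vec using (Vec; zipWith; map; replicate; foldr)
open import Data.List as List using (List)
open import Data.Bool using (Bool; true; false)
open import Data.Product using (Σ; ∃; ∃-syntax; _×_; _,_)
open import Data.Sum using (_⊎_)
open import Relation.Binary.PropositionalEquality using (_≡_; _≢_)
open import Relation.Nullary using (¬_; yes; no)

V : ℕ → Set
V n = Vec ℚ n

_⊕_ : ∀ {n} → V n → V n → V n
u ⊕ v = zipWith _+_ u v

_⊖_ : ∀ {n} → V n → V n → V n
u ⊖ v = zipWith _-_ u v

_•_ : ∀ {n} → ℚ → V n → V n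
c • v = map (c *_) v

𝟎 : ∀ {n} → V n
𝟎 = replicate _ 0ℚ

ℕ→ℚ : ℕ → ℚ
ℕ→ℚ k = (+ k) / 1

lincomb : ∀ {n m} → (Fin m → ℚ) → (Fin m → V n) → V n
lincomb {m = zero} c v = 𝟎
lincomb {m = suc m} c v = (c zero • v zero) ⊕ lincomb (λ k → c (suc k)) (λ k → v (suc k))

Gram : ℕ → Set
Gram n = Vec (Vec ℚ n) n

dot : ∀ {n} → V n → V n → ℚ
dot u v = foldr _ _+_ 0ℚ (zipWith _*_ u v)

⟪_⟫ : ∀ {n} → Gram n → V n → V n → ℚ
⟪ B ⟫ u v = dot u (map (λ row → dot row v) B)

IsInnerProduct : ∀ {n} → Gram n → Set
IsInnerProduct {n} B =
  (∀ u v → ⟪ B ⟫ u v ≡ ⟪ B ⟫ v u) × (∀ v → v ≢ 𝟎 → 0ℚ < ⟪ B ⟫ v v)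

-- total division (q = 0 never occurs for roots; result irrelevant there)
_÷'_ : ℚ → ℚ → ℚ
p ÷' q with q ≟ 0ℚ
... | yes _ = 0ℚ
... | no q≢0 = _÷_ p q {{≢-nonZero q≢0}}

cartan : ∀ {n} → Gram n → V n → V n → ℚ
cartan B β α = (ℕ→ℚ 2 * ⟪ B ⟫ β α) ÷' ⟪ B ⟫ α α

reflect : ∀ {n} → Gram n → V n → V n → V n
reflect B α β = β ⊖ (cartan B β α • α)

IsInteger : ℚ → Set
IsInteger q = Σ ℤ λ z → q ≡ z / 1

record IsRootSystem {n m : ℕ} (B : Gram n) (Φ : Fin m → V n) : Set where
  field
    innerProduct : IsInnerProduct B
    distinct     : ∀ k l → Φ k ≡ Φ l → k ≡ l
    nonzero      : ∀ k → Φ k ≢ 𝟎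
    spanning     : ∀ (v : V n) → ∃[ c ] v ≡ lincomb c Φ
    reflClosed   : ∀ k l → ∃[ k' ] reflect B (Φ k) (Φ l) ≡ Φ k'
    integral     : ∀ k l → IsInteger (cartan B (Φ l) (Φ k))

Reduced : ∀ {n m} → (Fin m → V n) → Set
Reduced Φ = ∀ k l (c : ℚ) → Φ l ≡ c • Φ k → c ≡ 1ℚ ⊎ c ≡ - 1ℚ

Irreducible : ∀ {n m} → Gram n → (Fin m → V n) → Set
Irreducible {m = m} B Φ =
  ∀ (P : Fin m → Bool) →
    (∀ k l → P k ≡ true → P l ≡ false → ⟪ B ⟫ (Φ k) (Φ l) ≡ 0ℚ) →
    (∀ k → P k ≡ true) ⊎ (∀ k → P k ≡ false)

IsPositive : ∀ {n r} → (Fin r → V n) → V n → Set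
IsPositive {r = r} Δ β = Σ (Fin r → ℕ) λ c → β ≡ lincomb (λ i → ℕ→ℚ (c i)) Δ

record IsBase {n m r : ℕ} (Φ : Fin m → V n) (simple : Fin r → Fin m) : Set where
  field
    linIndep : ∀ (c : Fin r → ℚ) → lincomb c (λ i → Φ (simple i)) ≡ 𝟎 → ∀ i → c i ≡ 0ℚ
    posOrNeg : ∀ k → IsPositive (λ i → Φ (simple i)) (Φ k)
                   ⊎ IsPositive (λ i → Φ (simple i)) (𝟎 ⊖ Φ k)

-- Dynkin diagram of type G₂: two nodes joined by a triple edge
TypeG₂ : ∀ {n m r} → Gram n → (Fin m → V n) → (Fin r → Fin m) → Set
TypeG₂ {r = r} B Φ simple =
  r ≡ 2 × ∃[ i ] ∃[ j ]
    cartan B (Φ (simple i)) (Φ (simple j)) * cartan B (Φ (simple j)) (Φ (simple i)) ≡ ℕ→ℚ 3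

-- normalization: short roots have squared length 2
ShortNormalized : ∀ {n m} → Gram n → (Fin m → V n) → Set
ShortNormalized B Φ = (∀ k → ℕ→ℚ 2 ≤ ⟪ B ⟫ (Φ k) (Φ k)) × (∃[ k ] ⟪ B ⟫ (Φ k) (Φ k) ≡ ℕ→ℚ 2)

-- Weyl group elements as words in the reflections s_α (α ∈ Φ); W is generated by them
act : ∀ {n m} → Gram n → (Fin m → V n) → List (Fin m) → V n → V n
act B Φ w v = List.foldr (λ k u → reflect B (Φ k) u) v w

{-# OPTIONS --safe #-}
-- Induction on the height of α.  Pick a simple root α_k with ⟨α, α_k⟩ > 0; if α = α_k take j = k and w = 1.
-- Otherwise s_k α is a positive root of smaller height.  If α_k ⊥ α_i, then s_k α satisfies the hypotheses
-- and s_k fixes α_i.  Otherwise α_i and α (which has squared length 2 by integrality) are short, and the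
-- Cartan integers force ⟨α_i, α_k⟩ = -⟨α, α_k⟩ = -⟨α_k, α_k⟩/2 ∈ {-1, -2, -3}.  For -1 the reflection in
-- s_k α = α - α_k fixes α_i and sends α_k to α.  For -2, s_i s_k α is a root of smaller height satisfying the
-- hypotheses, and s_k s_i s_k fixes α_i and sends s_i s_k α back to α.  A bond -3 forces type G₂: positive
-- definiteness makes every other simple root orthogonal to α_i and α_k, so by irreducibility there is none.
module Submission where

open import Defs
open import Data.Nat as ℕ using (ℕ; zero; suc)
import Data.Nat.Properties as ℕP
open import Data.Nat.Induction using (<-rec)
import Data.Nat.Coprimality as ℕC
open import Data.Integer as ℤ using (+_; -[1+_]; +[1+_])
import Data.Integer.Properties as ℤP
open import Data.Rational using (ℚ; mkℚ; -_; 0ℚ; 1ℚ; _+_; _*_; _-_; _≤_; _<_; _<?_; _/_; 1/_; *≤*; ≢-nonZero)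
import Data.Rational as ℚ
import Data.Rational.Properties as ℚP
open ℚP using (_≟_; <-irrefl; ≤-antisym; <⇒≤; <-≤-trans; ≮⇒≥)
open import Data.Fin as Fin using (Fin; zero; suc)
import Data.Fin.Properties as FinP
open import Data.Vec as Vec using ([]; _∷_)
import Data.Vec.Properties as VecP
open import Data.List using ([]; _∷_; _++_)
import Data.List.Properties as ListP
open import Data.Bool using (Bool; true; false; not)
import Data.Bool.Properties as BoolP
open import Data.Product using (Σ; ∃-syntax; _×_; _,_; proj₁; proj₂)
open import Data.Sum using (_⊎_; inj₁; inj₂)
open import Data.Empty using (⊥; ⊥-elim)
open import Function using (_∘_)
open import Relation.Binary.PropositionalEquality
open import Relation.Nullary using (¬_; yes; no; Dec; does)
open import Relation.Binary.Definitions using (tri<; tri≈; tri>)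
import Relation.Nullary.Decidable as Dec
open import Tactic.RingSolver using (solve-∀)
open import Tactic.RingSolver.Core.AlmostCommutativeRing using (AlmostCommutativeRing; fromCommutativeRing)
open import Algebra.Properties.Monoid.Sum ℚP.+-0-monoid using (sum; sum-cong-≗; sum-replicate-zero)
open import Algebra.Properties.Monoid.Sum ℕP.+-0-monoid using () renaming (sum to height; sum-cong-≗ to height-cong)

does≡true⇒ : ∀ {A : Set} (A? : Dec A) → does A? ≡ true → A
does≡true⇒ (yes a) _ = a

does≡false⇒ : ∀ {A : Set} (A? : Dec A) → does A? ≡ false → ¬ A
does≡false⇒ (no ¬a) _ = ¬a

ℚ-ring : AlmostCommutativeRing _ _
ℚ-ring = fromCommutativeRing ℚP.+-*-commutativeRing (λ x → Dec.dec⇒maybe (0ℚ ≟ x))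

/1≡mkℚ : ∀ z → z / 1 ≡ mkℚ z 0 (ℕC.sym (ℕC.1-coprimeTo ℤ.∣ z ∣))
/1≡mkℚ (+ n)    = ℚP.normalize-coprime (ℕC.sym (ℕC.1-coprimeTo n))
/1≡mkℚ -[1+ n ] = cong -_ (ℚP.normalize-coprime (ℕC.sym (ℕC.1-coprimeTo (suc n))))

/1-mono-≤ : ∀ {a b} → a ℤ.≤ b → a / 1 ≤ b / 1
/1-mono-≤ {a} {b} a≤b rewrite /1≡mkℚ a | /1≡mkℚ b =
  *≤* (subst₂ ℤ._≤_ (sym (ℤP.*-identityʳ a)) (sym (ℤP.*-identityʳ b)) a≤b)

/1-cancel-≤ : ∀ {a b} → a / 1 ≤ b / 1 → a ℤ.≤ b
/1-cancel-≤ {a} {b} a≤b rewrite /1≡mkℚ a | /1≡mkℚ b =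
  subst₂ ℤ._≤_ (ℤP.*-identityʳ a) (ℤP.*-identityʳ b) (ℚP.drop-*≤* a≤b)

/1-cancel-< : ∀ {a b} → a / 1 < b / 1 → a ℤ.< b
/1-cancel-< {a} {b} a<b rewrite /1≡mkℚ a | /1≡mkℚ b =
  subst₂ ℤ._<_ (ℤP.*-identityʳ a) (ℤP.*-identityʳ b) (ℚP.drop-*<* a<b)

/1-injective : ∀ {a b} → a / 1 ≡ b / 1 → a ≡ b
/1-injective e = ℤP.≤-antisym (/1-cancel-≤ (ℚP.≤-reflexive e)) (/1-cancel-≤ (ℚP.≤-reflexive (sym e)))

neg-/1 : ∀ z → - (z / 1) ≡ (ℤ.- z) / 1
neg-/1 (+ zero)   = refl
neg-/1 +[1+ n ]   = refl
neg-/1 -[1+ n ]   = neg-involutive (+[1+ n ] / 1)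
  where neg-involutive : ∀ x → - - x ≡ x
        neg-involutive = solve-∀ ℚ-ring

ℕ→ℚ-injective : ∀ {a b} → ℕ→ℚ a ≡ ℕ→ℚ b → a ≡ b
ℕ→ℚ-injective e = ℤP.+-injective (/1-injective e)

ℕ→ℚ-cancel-< : ∀ {a b} → ℕ→ℚ a < ℕ→ℚ b → a ℕ.< b
ℕ→ℚ-cancel-< a<b = ℤP.drop‿+<+ (/1-cancel-< a<b)

ℕ→ℚ-nonNeg : ∀ a → 0ℚ ≤ ℕ→ℚ a
ℕ→ℚ-nonNeg a = /1-mono-≤ {+ 0} {+ a} (ℤ.+≤+ ℕ.z≤n)

ℕ→ℚ-≡-neg⇒0 : ∀ {a b} → ℕ→ℚ a ≡ - ℕ→ℚ b → a ≡ 0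
ℕ→ℚ-≡-neg⇒0 {a} {b} a≡-b = ℕ→ℚ-injective {a} {0} (≤-antisym a≤0 (ℕ→ℚ-nonNeg a))
  where a≤0 : ℕ→ℚ a ≤ 0ℚ
        a≤0 = subst (_≤ 0ℚ) (sym a≡-b) (ℚP.neg-antimono-≤ (ℕ→ℚ-nonNeg b))

IsInteger-neg : ∀ {x} → IsInteger x → IsInteger (- x)
IsInteger-neg (z , refl) = ℤ.- z , neg-/1 z

integer<0⇒≤-1 : ∀ {x} → IsInteger x → x < 0ℚ → x ≤ - 1ℚ
integer<0⇒≤-1 (+ n , refl)      x<0 with ℤ.+<+ () ← /1-cancel-< {+ n} {+ 0} x<0
integer<0⇒≤-1 (-[1+ n ] , refl) x<0 = /1-mono-≤ { -[1+ n ]} { -[1+ 0 ]} (ℤ.-≤- ℕ.z≤n)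

-4<integer<0 : ∀ {x} → IsInteger x → - ℕ→ℚ 4 < x → x < 0ℚ →
  x ≡ - 1ℚ ⊎ x ≡ - ℕ→ℚ 2 ⊎ x ≡ - ℕ→ℚ 3
-4<integer<0 (+ n , refl)       _    x<0 with ℤ.+<+ () ← /1-cancel-< {+ n} {+ 0} x<0
-4<integer<0 (-[1+ 0 ] , refl)  _    _   = inj₁ refl
-4<integer<0 (-[1+ 1 ] , refl)  _    _   = inj₂ (inj₁ refl)
-4<integer<0 (-[1+ 2 ] , refl)  _    _   = inj₂ (inj₂ refl)
-4<integer<0 (-[1+ suc (suc (suc n)) ] , refl) -4<x _
  with ℤ.-<- (ℕ.s≤s (ℕ.s≤s (ℕ.s≤s ()))) ← /1-cancel-< { -[1+ 3 ]} { -[1+ suc (suc (suc n)) ]} -4<x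

p≡0⇒-p≡0 : ∀ {p} → p ≡ 0ℚ → - p ≡ 0ℚ
p≡0⇒-p≡0 refl = refl

<-compute : (p q : ℚ) → {Dec.True (p <? q)} → p < q
<-compute p q {p<q} = Dec.toWitness p<q

≤-compute : (p q : ℚ) → {Dec.True (p <? q)} → p ≤ q
≤-compute p q {p<q} = <⇒≤ (Dec.toWitness p<q)

<⇒≱ : ∀ {p q} → p < q → q ≤ p → ⊥
<⇒≱ p<q q≤p = <-irrefl refl (<-≤-trans p<q q≤p)

p≤q⇒0≤q-p : ∀ {p q} → p ≤ q → 0ℚ ≤ q - p
p≤q⇒0≤q-p {p} {q} p≤q = subst (_≤ q - p) (ℚP.+-inverseʳ p) (ℚP.+-monoˡ-≤ (- p) p≤q)

p<q⇒0<q-p : ∀ {p q} → p < q → 0ℚ < q - p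
p<q⇒0<q-p {p} {q} p<q = subst (_< q - p) (ℚP.+-inverseʳ p) (ℚP.+-monoˡ-< (- p) p<q)

p+[q-p]≡q : ∀ p q → p + (q - p) ≡ q
p+[q-p]≡q = solve-∀ ℚ-ring

≤-by-diff : ∀ {p q} d → q - p ≡ d → 0ℚ ≤ d → p ≤ q
≤-by-diff {p} {q} d q-p≡d 0≤d =
  subst₂ _≤_ (ℚP.+-identityʳ p) (p+[q-p]≡q p q) (ℚP.+-monoʳ-≤ p (subst (0ℚ ≤_) (sym q-p≡d) 0≤d))

<-by-diff : ∀ {p q} d → q - p ≡ d → 0ℚ < d → p < q
<-by-diff {p} {q} d q-p≡d 0<d =
  subst₂ _<_ (ℚP.+-identityʳ p) (p+[q-p]≡q p q) (ℚP.+-monoʳ-< p (subst (0ℚ <_) (sym q-p≡d) 0<d))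

*-pos : ∀ {p q} → 0ℚ < p → 0ℚ < q → 0ℚ < p * q
*-pos {p} {q} 0<p 0<q =
  ℚP.positive⁻¹ (p * q) {{ℚP.pos*pos⇒pos p {{ℚ.positive 0<p}} q {{ℚ.positive 0<q}}}}

*-nonNeg : ∀ {p q} → 0ℚ ≤ p → 0ℚ ≤ q → 0ℚ ≤ p * q
*-nonNeg {p} {q} 0≤p 0≤q =
  ℚP.nonNegative⁻¹ (p * q) {{ℚP.nonNeg*nonNeg⇒nonNeg p {{ℚ.nonNegative 0≤p}} q {{ℚ.nonNegative 0≤q}}}}

+-nonNeg : ∀ {p q} → 0ℚ ≤ p → 0ℚ ≤ q → 0ℚ ≤ p + q
+-nonNeg 0≤p 0≤q = ℚP.+-mono-≤ 0≤p 0≤q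

nonNeg*nonPos≤0 : ∀ {p q} → 0ℚ ≤ p → q ≤ 0ℚ → p * q ≤ 0ℚ
nonNeg*nonPos≤0 {p} {q} 0≤p q≤0 =
  ≤-by-diff (p * (0ℚ - q)) (negate p q) (*-nonNeg 0≤p (p≤q⇒0≤q-p q≤0))
  where negate : ∀ p q → 0ℚ - p * q ≡ p * (0ℚ - q)
        negate = solve-∀ ℚ-ring

÷'-*-cancel : ∀ p q → q ≢ 0ℚ → (p ÷' q) * q ≡ p
÷'-*-cancel p q q≢0 with q ≟ 0ℚ
... | yes q≡0 = ⊥-elim (q≢0 q≡0)
... | no q≢0 = trans (ℚP.*-assoc p (1/_ q {{≢-nonZero q≢0}}) q)
     (trans (cong (p *_) (ℚP.*-inverseˡ q {{≢-nonZero q≢0}})) (ℚP.*-identityʳ p))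

*-cancelʳ-≡ : ∀ {p q} r → r ≢ 0ℚ → p * r ≡ q * r → p ≡ q
*-cancelʳ-≡ {p} {q} r r≢0 pr≡qr =
  trans (sym (undo p)) (trans (cong (_* 1/_ r {{≢-nonZero r≢0}}) pr≡qr) (undo q))
  where undo : ∀ p → (p * r) * 1/_ r {{≢-nonZero r≢0}} ≡ p
        undo p = trans (ℚP.*-assoc p r _) (trans (cong (p *_) (ℚP.*-inverseʳ r {{≢-nonZero r≢0}})) (ℚP.*-identityʳ p))

½ : ℚ
½ = + 1 / 2

c*L≡2q⇒q≡½cL : ∀ {q c L} → c * L ≡ ℕ→ℚ 2 * q → q ≡ ½ * (c * L)
c*L≡2q⇒q≡½cL {q} e = trans (halve q) (cong (½ *_) (sym e))
  where halve : ∀ q → q ≡ ½ * (ℕ→ℚ 2 * q)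
        halve = solve-∀ ℚ-ring

dot-⊕ˡ : ∀ {n} (u v w : V n) → dot (u ⊕ v) w ≡ dot u w + dot v w
dot-⊕ˡ [] [] [] = refl
dot-⊕ˡ (a ∷ u) (b ∷ v) (c ∷ w) rewrite dot-⊕ˡ u v w = distrib a b c (dot u w) (dot v w)
  where distrib : ∀ a b c x y → (a + b) * c + (x + y) ≡ (a * c + x) + (b * c + y)
        distrib = solve-∀ ℚ-ring

dot-⊖ˡ : ∀ {n} (u v w : V n) → dot (u ⊖ v) w ≡ dot u w - dot v w
dot-⊖ˡ [] [] [] = refl
dot-⊖ˡ (a ∷ u) (b ∷ v) (c ∷ w) rewrite dot-⊖ˡ u v w = distrib a b c (dot u w) (dot v w)
  where distrib : ∀ a b c x y → (a - b) * c + (x - y) ≡ (a * c + x) - (b * c + y)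
        distrib = solve-∀ ℚ-ring

dot-•ˡ : ∀ {n} c (u w : V n) → dot (c • u) w ≡ c * dot u w
dot-•ˡ c [] [] = sym (ℚP.*-zeroʳ c)
dot-•ˡ c (a ∷ u) (b ∷ w) rewrite dot-•ˡ c u w = distrib c a b (dot u w)
  where distrib : ∀ c a b x → (c * a) * b + c * x ≡ c * (a * b + x)
        distrib = solve-∀ ℚ-ring

dot-𝟎ˡ : ∀ {n} (w : V n) → dot 𝟎 w ≡ 0ℚ
dot-𝟎ˡ [] = refl
dot-𝟎ˡ (b ∷ w) rewrite dot-𝟎ˡ w = cancel b
  where cancel : ∀ b → 0ℚ * b + 0ℚ ≡ 0ℚ
        cancel = solve-∀ ℚ-ring

1•-identity : ∀ {n} (v : V n) → 1ℚ • v ≡ v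
1•-identity [] = refl
1•-identity (a ∷ v) = cong₂ _∷_ (ℚP.*-identityˡ a) (1•-identity v)

•-𝟎 : ∀ {n} a → a • 𝟎 {n} ≡ 𝟎
•-𝟎 {zero} a = refl
•-𝟎 {suc n} a = cong₂ _∷_ (ℚP.*-zeroʳ a) (•-𝟎 a)

𝟎⊕𝟎 : ∀ {n} → 𝟎 {n} ⊕ 𝟎 ≡ 𝟎
𝟎⊕𝟎 {zero} = refl
𝟎⊕𝟎 {suc n} = cong₂ _∷_ (ℚP.+-identityʳ 0ℚ) 𝟎⊕𝟎

x⊖x≡𝟎 : ∀ {n} (x : V n) → x ⊖ x ≡ 𝟎
x⊖x≡𝟎 [] = refl
x⊖x≡𝟎 (a ∷ x) = cong₂ _∷_ (ℚP.+-inverseʳ a) (x⊖x≡𝟎 x)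

x⊖y≡𝟎⇒x≡y : ∀ {n} (x y : V n) → x ⊖ y ≡ 𝟎 → x ≡ y
x⊖y≡𝟎⇒x≡y [] [] _ = refl
x⊖y≡𝟎⇒x≡y (a ∷ x) (b ∷ y) e = cong₂ _∷_ (a-b≡0⇒a≡b (cong Vec.head e)) (x⊖y≡𝟎⇒x≡y x y (cong Vec.tail e))
  where a-b≡0⇒a≡b : a - b ≡ 0ℚ → a ≡ b
        a-b≡0⇒a≡b a-b≡0 = trans (sym (shift a b)) (trans (cong (_+ b) a-b≡0) (ℚP.+-identityˡ b))
          where shift : ∀ a b → (a - b) + b ≡ a
                shift = solve-∀ ℚ-ring

𝟎⊖-involutive : ∀ {n} (x : V n) → 𝟎 ⊖ (𝟎 ⊖ x) ≡ x
𝟎⊖-involutive [] = refl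
𝟎⊖-involutive (a ∷ x) = cong₂ _∷_ (involutive a) (𝟎⊖-involutive x)
  where involutive : ∀ a → 0ℚ - (0ℚ - a) ≡ a
        involutive = solve-∀ ℚ-ring

x⊖0•y≡x : ∀ {n} (x y : V n) → x ⊖ (0ℚ • y) ≡ x
x⊖0•y≡x [] [] = refl
x⊖0•y≡x (a ∷ x) (b ∷ y) = cong₂ _∷_ (cancel a b) (x⊖0•y≡x x y)
  where cancel : ∀ a b → a - 0ℚ * b ≡ a
        cancel = solve-∀ ℚ-ring

⊖•-⊖• : ∀ {n} c d (x y : V n) → (x ⊖ (c • y)) ⊖ (d • y) ≡ x ⊖ ((c + d) • y)
⊖•-⊖• c d [] [] = refl
⊖•-⊖• c d (a ∷ x) (b ∷ y) = cong₂ _∷_ (collect c d a b) (⊖•-⊖• c d x y)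
  where collect : ∀ c d a b → (a - c * b) - d * b ≡ a - (c + d) * b
        collect = solve-∀ ℚ-ring

x⊖2•x≡𝟎⊖x : ∀ {n} (x : V n) → x ⊖ (ℕ→ℚ 2 • x) ≡ 𝟎 ⊖ x
x⊖2•x≡𝟎⊖x [] = refl
x⊖2•x≡𝟎⊖x (a ∷ x) = cong₂ _∷_ (collect a) (x⊖2•x≡𝟎⊖x x)
  where collect : ∀ a → a - ℕ→ℚ 2 * a ≡ 0ℚ - a
        collect = solve-∀ ℚ-ring

y⊖-1•[x⊖1•y]≡x : ∀ {n} (x y : V n) → y ⊖ ((- 1ℚ) • (x ⊖ (1ℚ • y))) ≡ x
y⊖-1•[x⊖1•y]≡x [] [] = refl
y⊖-1•[x⊖1•y]≡x (a ∷ x) (b ∷ y) = cong₂ _∷_ (collect a b) (y⊖-1•[x⊖1•y]≡x x y)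
  where collect : ∀ a b → b - (- 1ℚ) * (a - 1ℚ * b) ≡ a
        collect = solve-∀ ℚ-ring

•⊕-⊖-•⊕ : ∀ {n} a b (x y z : V n) → ((a • x) ⊕ y) ⊖ ((b • x) ⊕ z) ≡ ((a - b) • x) ⊕ (y ⊖ z)
•⊕-⊖-•⊕ a b [] [] [] = refl
•⊕-⊖-•⊕ a b (p ∷ x) (q ∷ y) (s ∷ z) = cong₂ _∷_ (collect a b p q s) (•⊕-⊖-•⊕ a b x y z)
  where collect : ∀ a b p q s → (a * p + q) - (b * p + s) ≡ (a - b) * p + (q - s)
        collect = solve-∀ ℚ-ring

•⊕-⊕-•⊕ : ∀ {n} a b (x y z : V n) → ((a • x) ⊕ y) ⊕ ((b • x) ⊕ z) ≡ ((a + b) • x) ⊕ (y ⊕ z)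
•⊕-⊕-•⊕ a b [] [] [] = refl
•⊕-⊕-•⊕ a b (p ∷ x) (q ∷ y) (s ∷ z) = cong₂ _∷_ (collect a b p q s) (•⊕-⊕-•⊕ a b x y z)
  where collect : ∀ a b p q s → (a * p + q) + (b * p + s) ≡ (a + b) * p + (q + s)
        collect = solve-∀ ℚ-ring

•-distrib-•⊕ : ∀ {n} a b (x y : V n) → a • ((b • x) ⊕ y) ≡ ((a * b) • x) ⊕ (a • y)
•-distrib-•⊕ a b [] [] = refl
•-distrib-•⊕ a b (p ∷ x) (q ∷ y) = cong₂ _∷_ (distrib a b p q) (•-distrib-•⊕ a b x y)
  where distrib : ∀ a b p q → a * (b * p + q) ≡ (a * b) * p + a * q
        distrib = solve-∀ ℚ-ring

0•x⊕y≡y : ∀ {n} (x y : V n) → (0ℚ • x) ⊕ y ≡ y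
0•x⊕y≡y [] [] = refl
0•x⊕y≡y (a ∷ x) (b ∷ y) = cong₂ _∷_ (cancel a b) (0•x⊕y≡y x y)
  where cancel : ∀ a b → 0ℚ * a + b ≡ b
        cancel = solve-∀ ℚ-ring

1•x⊕𝟎≡x : ∀ {n} (x : V n) → (1ℚ • x) ⊕ 𝟎 ≡ x
1•x⊕𝟎≡x [] = refl
1•x⊕𝟎≡x (a ∷ x) = cong₂ _∷_ (cancel a) (1•x⊕𝟎≡x x)
  where cancel : ∀ a → 1ℚ * a + 0ℚ ≡ a
        cancel = solve-∀ ℚ-ring

sum-zero : ∀ {m} (f : Fin m → ℚ) → (∀ k → f k ≡ 0ℚ) → sum f ≡ 0ℚ
sum-zero {m} f f≗0 = trans (sum-cong-≗ f≗0) (sum-replicate-zero m)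

sum-pos⇒∃pos : ∀ {m} (f : Fin m → ℚ) → 0ℚ < sum f → ∃[ k ] 0ℚ < f k
sum-pos⇒∃pos {zero} f 0<0 = ⊥-elim (<-irrefl refl 0<0)
sum-pos⇒∃pos {suc m} f 0<sum with 0ℚ <? f zero | 0ℚ <? sum (f ∘ suc)
... | yes 0<f0 | _ = zero , 0<f0
... | no _ | yes 0<rest = let k , 0<fk = sum-pos⇒∃pos (f ∘ suc) 0<rest in suc k , 0<fk
... | no f0≤0 | no rest≤0 =
  ⊥-elim (<⇒≱ 0<sum (subst (f zero + sum (f ∘ suc) ≤_) (ℚP.+-identityʳ 0ℚ) (ℚP.+-mono-≤ (≮⇒≥ f0≤0) (≮⇒≥ rest≤0))))

unit : ∀ {r} → Fin r → Fin r → ℕ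
unit k l with l Fin.≟ k
... | yes _ = 1
... | no _ = 0

unit-diag : ∀ {r} (k : Fin r) → unit k k ≡ 1
unit-diag k with k Fin.≟ k
... | yes _ = refl
... | no k≢k = ⊥-elim (k≢k refl)

unit-offDiag : ∀ {r} (k l : Fin r) → l ≢ k → unit k l ≡ 0
unit-offDiag k l l≢k with l Fin.≟ k
... | yes l≡k = ⊥-elim (l≢k l≡k)
... | no _ = refl

lincomb-cong : ∀ {n m} {c d : Fin m → ℚ} (v : Fin m → V n) → (∀ k → c k ≡ d k) → lincomb c v ≡ lincomb d v
lincomb-cong {m = zero} v c≗d = refl
lincomb-cong {m = suc m} v c≗d = cong₂ _⊕_ (cong (_• v zero) (c≗d zero)) (lincomb-cong (v ∘ suc) (c≗d ∘ suc))

lincomb-zero : ∀ {n m} (v : Fin m → V n) → lincomb (λ _ → 0ℚ) v ≡ 𝟎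
lincomb-zero {m = zero} v = refl
lincomb-zero {m = suc m} v = trans (cong ((0ℚ • v zero) ⊕_) (lincomb-zero (v ∘ suc))) (0•x⊕y≡y (v zero) 𝟎)

lincomb-unit : ∀ {n m} (v : Fin m → V n) k → lincomb (ℕ→ℚ ∘ unit k) v ≡ v k
lincomb-unit {m = suc m} v zero = begin
  (ℕ→ℚ (unit {suc m} zero zero) • v zero) ⊕ lincomb (ℕ→ℚ ∘ unit {suc m} zero ∘ suc) (v ∘ suc)
    ≡⟨ cong₂ (λ c w → (ℕ→ℚ c • v zero) ⊕ w) (unit-diag {suc m} zero)
         (trans (lincomb-cong (v ∘ suc) (λ l → cong ℕ→ℚ (unit-offDiag zero (suc l) λ ()))) (lincomb-zero (v ∘ suc))) ⟩
  (1ℚ • v zero) ⊕ 𝟎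
    ≡⟨ 1•x⊕𝟎≡x (v zero) ⟩
  v zero ∎
  where open ≡-Reasoning
lincomb-unit {m = suc m} v (suc k) = begin
  (ℕ→ℚ (unit (suc k) zero) • v zero) ⊕ lincomb (ℕ→ℚ ∘ unit (suc k) ∘ suc) (v ∘ suc)
    ≡⟨ cong₂ (λ c w → (ℕ→ℚ c • v zero) ⊕ w) (unit-offDiag (suc k) zero λ ())
         (lincomb-cong (v ∘ suc) (cong ℕ→ℚ ∘ unit-suc)) ⟩
  (0ℚ • v zero) ⊕ lincomb (ℕ→ℚ ∘ unit k) (v ∘ suc)
    ≡⟨ 0•x⊕y≡y (v zero) _ ⟩
  lincomb (ℕ→ℚ ∘ unit k) (v ∘ suc)
    ≡⟨ lincomb-unit (v ∘ suc) k ⟩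
  v (suc k) ∎
  where
  open ≡-Reasoning
  unit-suc : ∀ l → unit (suc k) (suc l) ≡ unit k l
  unit-suc l = by-cases (l Fin.≟ k)
    where by-cases : Dec (l ≡ k) → unit (suc k) (suc l) ≡ unit k l
          by-cases (yes refl) = trans (unit-diag (suc k)) (sym (unit-diag k))
          by-cases (no l≢k) = trans (unit-offDiag (suc k) (suc l) (l≢k ∘ FinP.suc-injective)) (sym (unit-offDiag k l l≢k))

lincomb-⊖ : ∀ {n m} (c d : Fin m → ℚ) (v : Fin m → V n) → lincomb c v ⊖ lincomb d v ≡ lincomb (λ k → c k - d k) v
lincomb-⊖ {m = zero} c d v = x⊖x≡𝟎 𝟎
lincomb-⊖ {m = suc m} c d v = trans (•⊕-⊖-•⊕ (c zero) (d zero) (v zero) _ _)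
  (cong (((c zero - d zero) • v zero) ⊕_) (lincomb-⊖ (c ∘ suc) (d ∘ suc) (v ∘ suc)))

lincomb-⊕ : ∀ {n m} (c d : Fin m → ℚ) (v : Fin m → V n) → lincomb c v ⊕ lincomb d v ≡ lincomb (λ k → c k + d k) v
lincomb-⊕ {m = zero} c d v = 𝟎⊕𝟎
lincomb-⊕ {m = suc m} c d v = trans (•⊕-⊕-•⊕ (c zero) (d zero) (v zero) _ _)
  (cong (((c zero + d zero) • v zero) ⊕_) (lincomb-⊕ (c ∘ suc) (d ∘ suc) (v ∘ suc)))

lincomb-• : ∀ {n m} a (c : Fin m → ℚ) (v : Fin m → V n) → a • lincomb c v ≡ lincomb (λ k → a * c k) v
lincomb-• {m = zero} a c v = •-𝟎 a
lincomb-• {m = suc m} a c v = trans (•-distrib-•⊕ a (c zero) (v zero) _)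
  (cong (((a * c zero) • v zero) ⊕_) (lincomb-• a (c ∘ suc) (v ∘ suc)))

𝟎⊖lincomb : ∀ {n m} (c : Fin m → ℚ) (v : Fin m → V n) → 𝟎 ⊖ lincomb c v ≡ lincomb (λ k → - c k) v
𝟎⊖lincomb c v = begin
  𝟎 ⊖ lincomb c v                          ≡⟨ cong (_⊖ lincomb c v) (sym (lincomb-zero v)) ⟩
  lincomb (λ _ → 0ℚ) v ⊖ lincomb c v       ≡⟨ lincomb-⊖ (λ _ → 0ℚ) c v ⟩
  lincomb (λ k → 0ℚ - c k) v               ≡⟨ lincomb-cong v (λ k → ℚP.+-identityˡ (- c k)) ⟩
  lincomb (λ k → - c k) v                  ∎
  where open ≡-Reasoning

a•u⊖b•w≡𝟎⇒u≡b÷a•w : ∀ {n} a b (u w : V n) → a ≢ 0ℚ → (a • u) ⊖ (b • w) ≡ 𝟎 → u ≡ (b ÷' a) • w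
a•u⊖b•w≡𝟎⇒u≡b÷a•w a b [] [] a≢0 _ = refl
a•u⊖b•w≡𝟎⇒u≡b÷a•w a b (p ∷ u) (q ∷ w) a≢0 e =
  cong₂ _∷_ (*-cancelʳ-≡ a a≢0 (begin
    p * a                    ≡⟨ rearrange p a b q ⟩
    (a * p - b * q) + b * q  ≡⟨ cong (_+ b * q) (cong Vec.head e) ⟩
    0ℚ + b * q               ≡⟨ ℚP.+-identityˡ (b * q) ⟩
    b * q                    ≡⟨ cong (_* q) (÷'-*-cancel b a a≢0) ⟨
    ((b ÷' a) * a) * q       ≡⟨ swap (b ÷' a) a q ⟩
    ((b ÷' a) * q) * a       ∎))
  (a•u⊖b•w≡𝟎⇒u≡b÷a•w a b u w a≢0 (cong Vec.tail e))
  where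
  open ≡-Reasoning
  rearrange : ∀ p a b q → p * a ≡ (a * p - b * q) + b * q
  rearrange = solve-∀ ℚ-ring
  swap : ∀ c a q → (c * a) * q ≡ (c * q) * a
  swap = solve-∀ ℚ-ring

module InnerProduct {n : ℕ} (B : Gram n) (isInnerProduct : IsInnerProduct B) where

  ⟨_,_⟩ : V n → V n → ℚ
  ⟨_,_⟩ = ⟪ B ⟫

  ⟨⟩-sym : ∀ u v → ⟨ u , v ⟩ ≡ ⟨ v , u ⟩
  ⟨⟩-sym = proj₁ isInnerProduct

  ⟨⟩-posDef : ∀ v → v ≢ 𝟎 → 0ℚ < ⟨ v , v ⟩
  ⟨⟩-posDef = proj₂ isInnerProduct

  private
    Bv : V n → V n
    Bv v = Vec.map (λ row → dot row v) B

  ⟨⟩-⊕ˡ : ∀ u v w → ⟨ u ⊕ v , w ⟩ ≡ ⟨ u , w ⟩ + ⟨ v , w ⟩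
  ⟨⟩-⊕ˡ u v w = dot-⊕ˡ u v (Bv w)

  ⟨⟩-⊖ˡ : ∀ u v w → ⟨ u ⊖ v , w ⟩ ≡ ⟨ u , w ⟩ - ⟨ v , w ⟩
  ⟨⟩-⊖ˡ u v w = dot-⊖ˡ u v (Bv w)

  ⟨⟩-•ˡ : ∀ c u w → ⟨ c • u , w ⟩ ≡ c * ⟨ u , w ⟩
  ⟨⟩-•ˡ c u w = dot-•ˡ c u (Bv w)

  ⟨⟩-𝟎ˡ : ∀ w → ⟨ 𝟎 , w ⟩ ≡ 0ℚ
  ⟨⟩-𝟎ˡ w = dot-𝟎ˡ (Bv w)

  ⟨⟩-⊕ʳ : ∀ w u v → ⟨ w , u ⊕ v ⟩ ≡ ⟨ w , u ⟩ + ⟨ w , v ⟩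
  ⟨⟩-⊕ʳ w u v = trans (⟨⟩-sym w _) (trans (⟨⟩-⊕ˡ u v w) (cong₂ _+_ (⟨⟩-sym u w) (⟨⟩-sym v w)))

  ⟨⟩-•ʳ : ∀ w c u → ⟨ w , c • u ⟩ ≡ c * ⟨ w , u ⟩
  ⟨⟩-•ʳ w c u = trans (⟨⟩-sym w _) (trans (⟨⟩-•ˡ c u w) (cong (c *_) (⟨⟩-sym u w)))

  ⟨⟩-lincombˡ : ∀ {m} (c : Fin m → ℚ) (v : Fin m → V n) w → ⟨ lincomb c v , w ⟩ ≡ sum (λ k → c k * ⟨ v k , w ⟩)
  ⟨⟩-lincombˡ {zero} c v w = ⟨⟩-𝟎ˡ w
  ⟨⟩-lincombˡ {suc m} c v w =
    trans (⟨⟩-⊕ˡ (c zero • v zero) (lincomb (c ∘ suc) (v ∘ suc)) w)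
          (cong₂ _+_ (⟨⟩-•ˡ (c zero) (v zero) w) (⟨⟩-lincombˡ (c ∘ suc) (v ∘ suc) w))

  ⟨lincomb,⟩≡0 : ∀ {m} (c : Fin m → ℚ) (v : Fin m → V n) w →
                 (∀ k → c k ≡ 0ℚ ⊎ ⟨ v k , w ⟩ ≡ 0ℚ) → ⟨ lincomb c v , w ⟩ ≡ 0ℚ
  ⟨lincomb,⟩≡0 c v w vanish = trans (⟨⟩-lincombˡ c v w) (sum-zero _ (term≡0 ∘ vanish))
    where term≡0 : ∀ {k} → c k ≡ 0ℚ ⊎ ⟨ v k , w ⟩ ≡ 0ℚ → c k * ⟨ v k , w ⟩ ≡ 0ℚ
          term≡0 {k} (inj₁ ck≡0) = trans (cong (_* ⟨ v k , w ⟩) ck≡0) (ℚP.*-zeroˡ ⟨ v k , w ⟩)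
          term≡0 {k} (inj₂ ⟨⟩≡0) = trans (cong (c k *_) ⟨⟩≡0) (ℚP.*-zeroʳ (c k))

  ⟨⟩-expand₂ : ∀ p u q w → ⟨ (p • u) ⊖ (q • w) , (p • u) ⊖ (q • w) ⟩ ≡
               (p * p * ⟨ u , u ⟩ - ℕ→ℚ 2 * p * q * ⟨ u , w ⟩) + q * q * ⟨ w , w ⟩
  ⟨⟩-expand₂ p u q w = begin
    ⟨ X , X ⟩                                   ≡⟨ ⟨⟩-⊖ˡ (p • u) (q • w) X ⟩
    ⟨ p • u , X ⟩ - ⟨ q • w , X ⟩               ≡⟨ cong₂ _-_ (⟨⟩-•ˡ p u X) (⟨⟩-•ˡ q w X) ⟩
    p * ⟨ u , X ⟩ - q * ⟨ w , X ⟩               ≡⟨ cong₂ (λ a b → p * a - q * b) (uX u) (uX w) ⟩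
    p * (p * ⟨ u , u ⟩ - q * ⟨ w , u ⟩) - q * (p * ⟨ u , w ⟩ - q * ⟨ w , w ⟩)
      ≡⟨ cong (λ t → p * (p * ⟨ u , u ⟩ - q * t) - q * (p * ⟨ u , w ⟩ - q * ⟨ w , w ⟩)) (⟨⟩-sym w u) ⟩
    p * (p * ⟨ u , u ⟩ - q * ⟨ u , w ⟩) - q * (p * ⟨ u , w ⟩ - q * ⟨ w , w ⟩)
      ≡⟨ collect p q ⟨ u , u ⟩ ⟨ u , w ⟩ ⟨ w , w ⟩ ⟩
    (p * p * ⟨ u , u ⟩ - ℕ→ℚ 2 * p * q * ⟨ u , w ⟩) + q * q * ⟨ w , w ⟩ ∎
    where
    open ≡-Reasoning
    X = (p • u) ⊖ (q • w)
    uX : ∀ y → ⟨ y , X ⟩ ≡ p * ⟨ u , y ⟩ - q * ⟨ w , y ⟩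
    uX y = trans (⟨⟩-sym y X) (trans (⟨⟩-⊖ˡ (p • u) (q • w) y) (cong₂ _-_ (⟨⟩-•ˡ p u y) (⟨⟩-•ˡ q w y)))
    collect : ∀ p q A x C → p * (p * A - q * x) - q * (p * x - q * C) ≡ (p * p * A - ℕ→ℚ 2 * p * q * x) + q * q * C
    collect = solve-∀ ℚ-ring

  ⟨⟩-expand₃ : ∀ a b u w z → ⟨ ((a • u) ⊕ (b • w)) ⊕ z , ((a • u) ⊕ (b • w)) ⊕ z ⟩ ≡
               ((a * a * ⟨ u , u ⟩ + b * b * ⟨ w , w ⟩) + ⟨ z , z ⟩) +
               ((ℕ→ℚ 2 * a * b * ⟨ u , w ⟩ + ℕ→ℚ 2 * a * ⟨ u , z ⟩) + ℕ→ℚ 2 * b * ⟨ w , z ⟩)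
  ⟨⟩-expand₃ a b u w z = begin
    ⟨ X , X ⟩                                          ≡⟨ ⟨⟩-⊕ˡ ((a • u) ⊕ (b • w)) z X ⟩
    ⟨ (a • u) ⊕ (b • w) , X ⟩ + ⟨ z , X ⟩              ≡⟨ cong (_+ ⟨ z , X ⟩) (⟨⟩-⊕ˡ (a • u) (b • w) X) ⟩
    (⟨ a • u , X ⟩ + ⟨ b • w , X ⟩) + ⟨ z , X ⟩
      ≡⟨ cong₂ (λ p q → (p + q) + ⟨ z , X ⟩) (⟨⟩-•ˡ a u X) (⟨⟩-•ˡ b w X) ⟩
    (a * ⟨ u , X ⟩ + b * ⟨ w , X ⟩) + ⟨ z , X ⟩
      ≡⟨ cong₂ _+_ (cong₂ (λ p q → a * p + b * q) (yX u) (yX w)) (yX z) ⟩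
    (a * ((a * ⟨ u , u ⟩ + b * ⟨ u , w ⟩) + ⟨ u , z ⟩) + b * ((a * ⟨ w , u ⟩ + b * ⟨ w , w ⟩) + ⟨ w , z ⟩)) +
    ((a * ⟨ z , u ⟩ + b * ⟨ z , w ⟩) + ⟨ z , z ⟩)
      ≡⟨ collect a b ⟨ u , u ⟩ ⟨ w , w ⟩ ⟨ z , z ⟩ (⟨⟩-sym w u) (⟨⟩-sym z u) (⟨⟩-sym z w) ⟩
    ((a * a * ⟨ u , u ⟩ + b * b * ⟨ w , w ⟩) + ⟨ z , z ⟩) +
    ((ℕ→ℚ 2 * a * b * ⟨ u , w ⟩ + ℕ→ℚ 2 * a * ⟨ u , z ⟩) + ℕ→ℚ 2 * b * ⟨ w , z ⟩) ∎
    where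
    open ≡-Reasoning
    X = ((a • u) ⊕ (b • w)) ⊕ z
    yX : ∀ y → ⟨ y , X ⟩ ≡ (a * ⟨ y , u ⟩ + b * ⟨ y , w ⟩) + ⟨ y , z ⟩
    yX y = trans (⟨⟩-⊕ʳ y _ z) (cong (_+ ⟨ y , z ⟩) (trans (⟨⟩-⊕ʳ y _ _) (cong₂ _+_ (⟨⟩-•ʳ y a u) (⟨⟩-•ʳ y b w))))
    identity : ∀ a b U W Z uw uz wz →
               (a * ((a * U + b * uw) + uz) + b * ((a * uw + b * W) + wz)) + ((a * uz + b * wz) + Z) ≡
               ((a * a * U + b * b * W) + Z) + ((ℕ→ℚ 2 * a * b * uw + ℕ→ℚ 2 * a * uz) + ℕ→ℚ 2 * b * wz)
    identity = solve-∀ ℚ-ring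
    collect : ∀ a b U W Z {uw wu uz zu wz zw} → wu ≡ uw → zu ≡ uz → zw ≡ wz →
              (a * ((a * U + b * uw) + uz) + b * ((a * wu + b * W) + wz)) + ((a * zu + b * zw) + Z) ≡
              ((a * a * U + b * b * W) + Z) + ((ℕ→ℚ 2 * a * b * uw + ℕ→ℚ 2 * a * uz) + ℕ→ℚ 2 * b * wz)
    collect a b U W Z refl refl refl = identity a b U W Z _ _ _

  cartan-* : ∀ β α → ⟨ α , α ⟩ ≢ 0ℚ → cartan B β α * ⟨ α , α ⟩ ≡ ℕ→ℚ 2 * ⟨ β , α ⟩
  cartan-* β α = ÷'-*-cancel _ _

  reflect-⟨⟩ˡ : ∀ α β γ → ⟨ reflect B α β , γ ⟩ ≡ ⟨ β , γ ⟩ - cartan B β α * ⟨ α , γ ⟩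
  reflect-⟨⟩ˡ α β γ = trans (⟨⟩-⊖ˡ β _ γ) (cong (λ t → ⟨ β , γ ⟩ - t) (⟨⟩-•ˡ (cartan B β α) α γ))

  reflect-⟨⟩ʳ : ∀ α β γ → ⟨ γ , reflect B α β ⟩ ≡ ⟨ γ , β ⟩ - cartan B β α * ⟨ γ , α ⟩
  reflect-⟨⟩ʳ α β γ = trans (⟨⟩-sym γ _) (trans (reflect-⟨⟩ˡ α β γ) (cong₂ (λ a b → a - cartan B β α * b) (⟨⟩-sym β γ) (⟨⟩-sym α γ)))

  reflect-⊥ : ∀ α β → ⟨ β , α ⟩ ≡ 0ℚ → reflect B α β ≡ β
  reflect-⊥ α β ⟨β,α⟩≡0 =
    trans (cong (λ x → β ⊖ (((ℕ→ℚ 2 * x) ÷' ⟨ α , α ⟩) • α)) ⟨β,α⟩≡0)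
          (trans (cong (λ c → β ⊖ (c • α)) (0÷'q≡0 ⟨ α , α ⟩)) (x⊖0•y≡x β α))
    where 0÷'q≡0 : ∀ q → (ℕ→ℚ 2 * 0ℚ) ÷' q ≡ 0ℚ
          0÷'q≡0 q with q ≟ 0ℚ
          ... | yes _ = refl
          ... | no q≢0 = ℚP.*-zeroˡ (1/_ q {{≢-nonZero q≢0}})

  reflect-self-⟨⟩ : ∀ α β → ⟨ α , α ⟩ ≢ 0ℚ → ⟨ reflect B α β , α ⟩ ≡ - ⟨ β , α ⟩
  reflect-self-⟨⟩ α β A≢0 = trans (reflect-⟨⟩ˡ α β α) (trans (cong (λ t → ⟨ β , α ⟩ - t) (cartan-* β α A≢0)) (x-2x≡-x ⟨ β , α ⟩))
    where x-2x≡-x : ∀ x → x - ℕ→ℚ 2 * x ≡ - x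
          x-2x≡-x = solve-∀ ℚ-ring

  reflect-self : ∀ α → ⟨ α , α ⟩ ≢ 0ℚ → reflect B α α ≡ 𝟎 ⊖ α
  reflect-self α A≢0 = trans (cong (λ c → α ⊖ (c • α)) cartan≡2) (x⊖2•x≡𝟎⊖x α)
    where cartan≡2 : cartan B α α ≡ ℕ→ℚ 2
          cartan≡2 = *-cancelʳ-≡ ⟨ α , α ⟩ A≢0 (cartan-* α α A≢0)

  reflect-involutive : ∀ α β → ⟨ α , α ⟩ ≢ 0ℚ → reflect B α (reflect B α β) ≡ β
  reflect-involutive α β A≢0 = begin
    reflect B α (reflect B α β)          ≡⟨ ⊖•-⊖• (cartan B β α) (cartan B (reflect B α β) α) β α ⟩
    β ⊖ ((cartan B β α + cartan B (reflect B α β) α) • α)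
      ≡⟨ cong (λ t → β ⊖ ((cartan B β α + t) • α)) cartan-reflect ⟩
    β ⊖ ((cartan B β α + - cartan B β α) • α) ≡⟨ cong (λ t → β ⊖ (t • α)) (ℚP.+-inverseʳ (cartan B β α)) ⟩
    β ⊖ (0ℚ • α)                         ≡⟨ x⊖0•y≡x β α ⟩
    β ∎
    where
    open ≡-Reasoning
    cartan-reflect : cartan B (reflect B α β) α ≡ - cartan B β α
    cartan-reflect = *-cancelʳ-≡ ⟨ α , α ⟩ A≢0
      (trans (cartan-* (reflect B α β) α A≢0)
        (trans (cong (ℕ→ℚ 2 *_) (reflect-self-⟨⟩ α β A≢0)) (negate {⟨ β , α ⟩} {cartan B β α} (cartan-* β α A≢0))))
      where negate : ∀ {x c A} → c * A ≡ ℕ→ℚ 2 * x → ℕ→ℚ 2 * (- x) ≡ (- c) * A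
            negate {x} {c} {A} cA≡2x rewrite c*L≡2q⇒q≡½cL {x} {c} {A} cA≡2x = identity c A
              where identity : ∀ c A → ℕ→ℚ 2 * (- (½ * (c * A))) ≡ (- c) * A
                    identity = solve-∀ ℚ-ring

  reflect-conjugate-fix : ∀ α β → ⟨ α , α ⟩ ≢ 0ℚ → ⟨ reflect B α β , β ⟩ ≡ 0ℚ →
                          reflect B α (reflect B β (reflect B α β)) ≡ β
  reflect-conjugate-fix α β A≢0 ⟨sβ,β⟩≡0 =
    trans (cong (reflect B α) (reflect-⊥ β (reflect B α β) ⟨sβ,β⟩≡0)) (reflect-involutive α β A≢0)

  reflect-isometry : ∀ α β γ → ⟨ α , α ⟩ ≢ 0ℚ → ⟨ reflect B α β , reflect B α γ ⟩ ≡ ⟨ β , γ ⟩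
  reflect-isometry α β γ A≢0 =
    trans (reflect-⟨⟩ˡ α β _)
      (trans (cong₂ (λ a b → a - cartan B β α * b) (reflect-⟨⟩ʳ α γ β) (reflect-⟨⟩ʳ α γ α))
        (cancel ⟨ β , γ ⟩ ⟨ β , α ⟩ ⟨ α , γ ⟩ (cartan B β α) (cartan B γ α) ⟨ α , α ⟩
          (cartan-* β α A≢0) (trans (cartan-* γ α A≢0) (cong (ℕ→ℚ 2 *_) (⟨⟩-sym γ α)))))
    where
    cancel : ∀ P x y c d A → c * A ≡ ℕ→ℚ 2 * x → d * A ≡ ℕ→ℚ 2 * y → (P - d * x) - c * (y - d * A) ≡ P
    cancel P x y c d A cA≡2x dA≡2y
      rewrite c*L≡2q⇒q≡½cL {x} {c} {A} cA≡2x | c*L≡2q⇒q≡½cL {y} {d} {A} dA≡2y = identity P c d A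
      where identity : ∀ P c d A → (P - d * (½ * (c * A))) - c * (½ * (d * A) - d * A) ≡ P
            identity = solve-∀ ℚ-ring

  cauchySchwarz-strict : ∀ u v → v ≢ 𝟎 →
    u ≡ (⟨ u , v ⟩ ÷' ⟨ v , v ⟩) • v ⊎ ⟨ u , v ⟩ * ⟨ u , v ⟩ < ⟨ u , u ⟩ * ⟨ v , v ⟩
  cauchySchwarz-strict u v v≢𝟎 with VecP.≡-dec _≟_ ((⟨ v , v ⟩ • u) ⊖ (⟨ u , v ⟩ • v)) 𝟎
  ... | yes X≡𝟎 = inj₁ (a•u⊖b•w≡𝟎⇒u≡b÷a•w _ _ u v (λ C≡0 → <-irrefl (sym C≡0) 0<C) X≡𝟎)
    where 0<C = ⟨⟩-posDef v v≢𝟎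
  ... | no X≢𝟎 = inj₂ (<-by-diff _ refl (ℚP.*-cancelˡ-<-nonNeg C {{ℚ.nonNegative (<⇒≤ 0<C)}}
                   (subst₂ _<_ (sym (ℚP.*-zeroʳ C)) expand (⟨⟩-posDef _ X≢𝟎))))
    where
    C = ⟨ v , v ⟩
    0<C = ⟨⟩-posDef v v≢𝟎
    factor : ∀ A x C → (C * C * A - ℕ→ℚ 2 * C * x * x) + x * x * C ≡ C * (A * C - x * x)
    factor = solve-∀ ℚ-ring
    expand : ⟨ (C • u) ⊖ (⟨ u , v ⟩ • v) , (C • u) ⊖ (⟨ u , v ⟩ • v) ⟩ ≡ C * (⟨ u , u ⟩ * C - ⟨ u , v ⟩ * ⟨ u , v ⟩)
    expand = trans (⟨⟩-expand₂ C u ⟨ u , v ⟩ v) (factor ⟨ u , u ⟩ ⟨ u , v ⟩ C)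

c*L≡2q⇒c<0 : ∀ {c L q} → c * L ≡ ℕ→ℚ 2 * q → 0ℚ < L → q < 0ℚ → c < 0ℚ
c*L≡2q⇒c<0 {c} {L} {q} cL≡2q 0<L q<0 with 0ℚ ℚP.≤? c
... | no 0≰c = ℚP.≰⇒> 0≰c
... | yes 0≤c = ⊥-elim (<⇒≱ 2q<0 (subst (0ℚ ≤_) cL≡2q (*-nonNeg 0≤c (<⇒≤ 0<L))))
  where
  negate : ∀ q → 0ℚ - ℕ→ℚ 2 * q ≡ ℕ→ℚ 2 * (0ℚ - q)
  negate = solve-∀ ℚ-ring
  2q<0 : ℕ→ℚ 2 * q < 0ℚ
  2q<0 = <-by-diff (ℕ→ℚ 2 * (0ℚ - q)) (negate q) (*-pos (<-compute 0ℚ (ℕ→ℚ 2)) (p<q⇒0<q-p q<0))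

integer-c*L≡2q⇒L≤-2q : ∀ {c L q} → IsInteger c → c * L ≡ ℕ→ℚ 2 * q → 0ℚ < L → q < 0ℚ → L ≤ - (ℕ→ℚ 2 * q)
integer-c*L≡2q⇒L≤-2q {c} {L} {q} c∈ℤ cL≡2q 0<L q<0 =
  ≤-by-diff ((- 1ℚ - c) * L) (trans (cong (λ t → - t - L) (sym cL≡2q)) (factor c L))
    (*-nonNeg (p≤q⇒0≤q-p (integer<0⇒≤-1 c∈ℤ (c*L≡2q⇒c<0 cL≡2q 0<L q<0))) (<⇒≤ 0<L))
  where factor : ∀ c L → - (c * L) - L ≡ (- 1ℚ - c) * L
        factor = solve-∀ ℚ-ring

-- For a short root α and a root β ≠ ±α, these are q = ⟨α, β⟩ = ⟨β, α^∨⟩, c = ⟨α, β^∨⟩ and L = ⟨β, β⟩.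
shortPairing-numeric : ∀ {q c L} → IsInteger q → IsInteger c → c * L ≡ ℕ→ℚ 2 * q → ℕ→ℚ 2 ≤ L →
  q * q < ℕ→ℚ 2 * L → q < 0ℚ → L ≡ - (ℕ→ℚ 2 * q) × (q ≡ - 1ℚ ⊎ q ≡ - ℕ→ℚ 2 ⊎ q ≡ - ℕ→ℚ 3)
shortPairing-numeric {q} {c} {L} q∈ℤ c∈ℤ cL≡2q 2≤L q²<2L q<0 = L≡-2q , -4<integer<0 q∈ℤ -4<q q<0
  where
  0<L : 0ℚ < L
  0<L = <-≤-trans (<-compute 0ℚ (ℕ→ℚ 2)) 2≤L

  -- With d = -2 - c ≥ 0 and q = cL/2, q² - 2L is L times a polynomial in d and L - 2 with nonnegative coefficients.
  certificate : ∀ c L → (½ * (c * L)) * (½ * (c * L)) - ℕ→ℚ 2 * L ≡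
    L * ((((L - ℕ→ℚ 2) + ℕ→ℚ 2 * (- ℕ→ℚ 2 - c)) + (- ℕ→ℚ 2 - c) * (L - ℕ→ℚ 2)) +
         (½ * ((- ℕ→ℚ 2 - c) * (- ℕ→ℚ 2 - c)) + (+ 1 / 4 * ((- ℕ→ℚ 2 - c) * (- ℕ→ℚ 2 - c))) * (L - ℕ→ℚ 2)))
  certificate = solve-∀ ℚ-ring

  -2<c : - ℕ→ℚ 2 < c
  -2<c with c ℚP.≤? - ℕ→ℚ 2
  ... | no c≰-2 = ℚP.≰⇒> c≰-2
  ... | yes c≤-2 = ⊥-elim (<⇒≱ q²<2L (≤-by-diff _
          (trans (cong (λ t → t * t - ℕ→ℚ 2 * L) (c*L≡2q⇒q≡½cL {q} {c} {L} cL≡2q)) (certificate c L))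
          (*-nonNeg (<⇒≤ 0<L) (+-nonNeg (+-nonNeg (+-nonNeg L-2 (*-nonNeg (≤-compute 0ℚ (ℕ→ℚ 2)) d)) (*-nonNeg d L-2))
                                        (+-nonNeg (*-nonNeg (≤-compute 0ℚ ½) (*-nonNeg d d))
                                                  (*-nonNeg (*-nonNeg (≤-compute 0ℚ (+ 1 / 4)) (*-nonNeg d d)) L-2))))))
    where
    d : 0ℚ ≤ - ℕ→ℚ 2 - c
    d = p≤q⇒0≤q-p c≤-2
    L-2 : 0ℚ ≤ L - ℕ→ℚ 2
    L-2 = p≤q⇒0≤q-p 2≤L

  c≡-1 : c ≡ - 1ℚ
  c≡-1 with -4<integer<0 c∈ℤ (ℚP.<-trans (<-compute (- ℕ→ℚ 4) (- ℕ→ℚ 2)) -2<c) (c*L≡2q⇒c<0 cL≡2q 0<L q<0)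
  ... | inj₁ c≡-1 = c≡-1
  ... | inj₂ (inj₁ refl) = ⊥-elim (<-irrefl refl -2<c)
  ... | inj₂ (inj₂ refl) = ⊥-elim (ℚP.<-asym (<-compute (- ℕ→ℚ 3) (- ℕ→ℚ 2)) -2<c)

  L≡-2q : L ≡ - (ℕ→ℚ 2 * q)
  L≡-2q = trans (negate-twice L) (cong -_ (trans (cong (_* L) (sym c≡-1)) cL≡2q))
    where negate-twice : ∀ L → L ≡ - (- 1ℚ * L)
          negate-twice = solve-∀ ℚ-ring

  -4<q : - ℕ→ℚ 4 < q
  -4<q with q ℚP.≤? - ℕ→ℚ 4
  ... | no q≰-4 = ℚP.≰⇒> q≰-4
  ... | yes q≤-4 = ⊥-elim (<⇒≱ q²<2L (≤-by-diff ((0ℚ - q) * (- ℕ→ℚ 4 - q))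
          (trans (cong (λ t → q * q - ℕ→ℚ 2 * t) L≡-2q) (factor q))
          (*-nonNeg (p≤q⇒0≤q-p (<⇒≤ q<0)) (p≤q⇒0≤q-p q≤-4))))
    where factor : ∀ q → q * q - ℕ→ℚ 2 * (- (ℕ→ℚ 2 * q)) ≡ (0ℚ - q) * (- ℕ→ℚ 4 - q)
          factor = solve-∀ ℚ-ring

shortPairing-numeric⁺ : ∀ {q c L} → IsInteger q → IsInteger c → c * L ≡ ℕ→ℚ 2 * q → ℕ→ℚ 2 ≤ L →
  q * q < ℕ→ℚ 2 * L → 0ℚ < q → L ≡ ℕ→ℚ 2 * q
shortPairing-numeric⁺ {q} {c} {L} q∈ℤ c∈ℤ cL≡2q 2≤L q²<2L 0<q =
  trans (proj₁ (shortPairing-numeric (IsInteger-neg q∈ℤ) (IsInteger-neg c∈ℤ) [-c]L≡2[-q] 2≤L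
                  (subst (_< ℕ→ℚ 2 * L) (square-neg q) q²<2L) (ℚP.neg-antimono-< 0<q)))
        (double-neg q)
  where
  square-neg : ∀ q → q * q ≡ (- q) * (- q)
  square-neg = solve-∀ ℚ-ring
  double-neg : ∀ q → - (ℕ→ℚ 2 * (- q)) ≡ ℕ→ℚ 2 * q
  double-neg = solve-∀ ℚ-ring
  negate : ∀ c L q → c * L ≡ ℕ→ℚ 2 * q → (- c) * L ≡ ℕ→ℚ 2 * (- q)
  negate c L q cL≡2q rewrite c*L≡2q⇒q≡½cL {q} {c} {L} cL≡2q = identity c L
    where identity : ∀ c L → (- c) * L ≡ ℕ→ℚ 2 * (- (½ * (c * L)))
          identity = solve-∀ ℚ-ring
  [-c]L≡2[-q] = negate c L q cL≡2q

height-< : ∀ {r} (e e' : Fin r → ℕ) k → (∀ l → l ≢ k → e' l ≡ e l) → e' k ℕ.< e k → height e' ℕ.< height e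
height-< {suc r} e e' zero off e'k<ek =
  subst (λ t → e' zero ℕ.+ t ℕ.< e zero ℕ.+ height (e ∘ suc))
        (height-cong (λ l → sym (off (suc l) λ ())))
        (ℕP.+-monoˡ-< (height (e ∘ suc)) e'k<ek)
height-< {suc r} e e' (suc k) off e'k<ek rewrite off zero (λ ()) =
  ℕP.+-monoʳ-< (e zero) (height-< (e ∘ suc) (e' ∘ suc) k (λ l l≢k → off (suc l) (l≢k ∘ FinP.suc-injective)) e'k<ek)

ℕ→ℚ-≡-pos⇒< : ∀ {a b p} → ℕ→ℚ a ≡ ℕ→ℚ b - p → 0ℚ < p → a ℕ.< b
ℕ→ℚ-≡-pos⇒< {a} {b} {p} a≡b-p 0<p = ℕ→ℚ-cancel-< (subst (_< ℕ→ℚ b) (sym a≡b-p) (<-by-diff p (cancel (ℕ→ℚ b) p) 0<p))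
  where cancel : ∀ b p → b - (b - p) ≡ p
        cancel = solve-∀ ℚ-ring

module RootSystem {n m r : ℕ} (B : Gram n) (Φ : Fin m → V n) (simple : Fin r → Fin m)
                  (RS : IsRootSystem B Φ) (red : Reduced Φ) (base : IsBase Φ simple) where

  open IsRootSystem RS
  open IsBase base
  open InnerProduct B innerProduct public

  Δ : Fin r → V n
  Δ k = Φ (simple k)

  ∣Φ∣²>0 : ∀ k → 0ℚ < ⟨ Φ k , Φ k ⟩
  ∣Φ∣²>0 k = ⟨⟩-posDef (Φ k) (nonzero k)

  ∣Φ∣²≢0 : ∀ k → ⟨ Φ k , Φ k ⟩ ≢ 0ℚ
  ∣Φ∣²≢0 k ∣Φk∣²≡0 = <-irrefl (sym ∣Φk∣²≡0) (∣Φ∣²>0 k)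

  HasCoeffs : Fin m → (Fin r → ℕ) → Set
  HasCoeffs b e = Φ b ≡ lincomb (ℕ→ℚ ∘ e) Δ

  coeffs-unique : ∀ (x y : Fin r → ℚ) → lincomb x Δ ≡ lincomb y Δ → ∀ l → x l ≡ y l
  coeffs-unique x y x≡y l = x-y≡0⇒x≡y (linIndep (λ l → x l - y l)
      (trans (sym (lincomb-⊖ x y Δ)) (trans (cong (_⊖ lincomb y Δ) x≡y) (x⊖x≡𝟎 _))) l)
    where x-y≡0⇒x≡y : x l - y l ≡ 0ℚ → x l ≡ y l
          x-y≡0⇒x≡y d≡0 = trans (sym (shift (x l) (y l))) (trans (cong (_+ y l) d≡0) (ℚP.+-identityˡ (y l)))
            where shift : ∀ a b → (a - b) + b ≡ a
                  shift = solve-∀ ℚ-ring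

  simple-hasCoeffs : ∀ k → HasCoeffs (simple k) (unit k)
  simple-hasCoeffs k = sym (lincomb-unit Δ k)

  simple-not-multiple : ∀ k l c → k ≢ l → Δ k ≢ c • Δ l
  simple-not-multiple k l c k≢l Δk≡cΔl = ℚP.1≢0 (begin
    1ℚ                          ≡⟨ cong ℕ→ℚ (unit-diag k) ⟨
    ℕ→ℚ (unit k k)              ≡⟨ coeffs-unique (ℕ→ℚ ∘ unit k) (λ l' → c * ℕ→ℚ (unit l l')) Δk≡Σ k ⟩
    c * ℕ→ℚ (unit l k)          ≡⟨ cong (λ t → c * ℕ→ℚ t) (unit-offDiag l k k≢l) ⟩
    c * 0ℚ                      ≡⟨ ℚP.*-zeroʳ c ⟩
    0ℚ ∎)
    where
    open ≡-Reasoning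
    Δk≡Σ : lincomb (ℕ→ℚ ∘ unit k) Δ ≡ lincomb (λ l' → c * ℕ→ℚ (unit l l')) Δ
    Δk≡Σ = trans (sym (simple-hasCoeffs k))
             (trans Δk≡cΔl (trans (cong (c •_) (simple-hasCoeffs l)) (lincomb-• c (ℕ→ℚ ∘ unit l) Δ)))

  simple-injective : ∀ k l → Δ k ≡ Δ l → k ≡ l
  simple-injective k l Δk≡Δl with k Fin.≟ l
  ... | yes k≡l = k≡l
  ... | no k≢l = ⊥-elim (simple-not-multiple k l 1ℚ k≢l (trans Δk≡Δl (sym (1•-identity (Δ l)))))

  SignedCoeffs : (Fin r → ℚ) → Set
  SignedCoeffs x = (Σ (Fin r → ℕ) λ e → ∀ l → x l ≡ ℕ→ℚ (e l)) ⊎ (Σ (Fin r → ℕ) λ e → ∀ l → x l ≡ - ℕ→ℚ (e l))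

  signedCoeffs : ∀ b (x : Fin r → ℚ) → Φ b ≡ lincomb x Δ → SignedCoeffs x
  signedCoeffs b x b≡Σx with posOrNeg b
  ... | inj₁ (e , b≡Σe) = inj₁ (e , coeffs-unique x (ℕ→ℚ ∘ e) (trans (sym b≡Σx) b≡Σe))
  ... | inj₂ (e , -b≡Σe) = inj₂ (e , coeffs-unique x (λ l → - ℕ→ℚ (e l))
          (trans (sym b≡Σx) (trans (sym (𝟎⊖-involutive (Φ b))) (trans (cong (𝟎 ⊖_) -b≡Σe) (𝟎⊖lincomb (ℕ→ℚ ∘ e) Δ)))))

  supportedAt⇒simple : ∀ {b e} k → HasCoeffs b e → (∀ l → l ≢ k → e l ≡ 0) → Φ b ≡ Δ k
  supportedAt⇒simple {b} {e} k b≡Σe off = by-reducedness (red (simple k) b (ℕ→ℚ (e k)) b≡ek•Δk)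
    where
    scaled : ∀ l → Dec (l ≡ k) → ℕ→ℚ (e l) ≡ ℕ→ℚ (e k) * ℕ→ℚ (unit k l)
    scaled l (yes refl) = sym (trans (cong (λ t → ℕ→ℚ (e l) * ℕ→ℚ t) (unit-diag l)) (ℚP.*-identityʳ (ℕ→ℚ (e l))))
    scaled l (no l≢k) = trans (cong ℕ→ℚ (off l l≢k))
                          (sym (trans (cong (λ t → ℕ→ℚ (e k) * ℕ→ℚ t) (unit-offDiag k l l≢k)) (ℚP.*-zeroʳ (ℕ→ℚ (e k)))))
    b≡ek•Δk : Φ b ≡ ℕ→ℚ (e k) • Δ k
    b≡ek•Δk = trans b≡Σe (trans (lincomb-cong Δ (λ l → scaled l (l Fin.≟ k)))
                (trans (sym (lincomb-• (ℕ→ℚ (e k)) (ℕ→ℚ ∘ unit k) Δ)) (cong (ℕ→ℚ (e k) •_) (lincomb-unit Δ k))))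
    by-reducedness : ℕ→ℚ (e k) ≡ 1ℚ ⊎ ℕ→ℚ (e k) ≡ - 1ℚ → Φ b ≡ Δ k
    by-reducedness (inj₁ ek≡1) = trans b≡ek•Δk (trans (cong (_• Δ k) ek≡1) (1•-identity (Δ k)))
    by-reducedness (inj₂ ek≡-1) = ⊥-elim (<⇒≱ (<-compute (- 1ℚ) 0ℚ) (subst (0ℚ ≤_) ek≡-1 (ℕ→ℚ-nonNeg (e k))))

  record SimpleReflection (b : Fin m) (e : Fin r → ℕ) (k : Fin r) : Set where
    field
      root       : Fin m
      coeffs     : Fin r → ℕ
      reflects   : reflect B (Δ k) (Φ b) ≡ Φ root
      hasCoeffs  : HasCoeffs root coeffs
      coeffs-off : ∀ l → l ≢ k → coeffs l ≡ e l
      coeffs-at  : ℕ→ℚ (coeffs k) ≡ ℕ→ℚ (e k) - cartan B (Φ b) (Δ k)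

  -- If s_k b is a negative root then, Φ being reduced, b = α_k.
  reflectSimple : ∀ {b e} → HasCoeffs b e → ∀ k → Φ b ≡ Δ k ⊎ SimpleReflection b e k
  reflectSimple {b} {e} b≡Σe k = by-sign (reflClosed (simple k) b)
    where
    p = cartan B (Φ b) (Δ k)
    x : Fin r → ℚ
    x l = ℕ→ℚ (e l) - p * ℕ→ℚ (unit k l)
    sb≡Σx : reflect B (Δ k) (Φ b) ≡ lincomb x Δ
    sb≡Σx = trans (cong₂ _⊖_ b≡Σe (trans (cong (p •_) (simple-hasCoeffs k)) (lincomb-• p (ℕ→ℚ ∘ unit k) Δ)))
                  (lincomb-⊖ (ℕ→ℚ ∘ e) (λ l → p * ℕ→ℚ (unit k l)) Δ)
    x-off : ∀ l → l ≢ k → x l ≡ ℕ→ℚ (e l)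
    x-off l l≢k = trans (cong (λ t → ℕ→ℚ (e l) - p * ℕ→ℚ t) (unit-offDiag k l l≢k)) (cancel (ℕ→ℚ (e l)) p)
      where cancel : ∀ a p → a - p * 0ℚ ≡ a
            cancel = solve-∀ ℚ-ring
    x-at : x k ≡ ℕ→ℚ (e k) - p
    x-at = trans (cong (λ t → ℕ→ℚ (e k) - p * ℕ→ℚ t) (unit-diag k)) (cancel (ℕ→ℚ (e k)) p)
      where cancel : ∀ a p → a - p * 1ℚ ≡ a - p
            cancel = solve-∀ ℚ-ring
    by-sign : ∃[ b' ] reflect B (Δ k) (Φ b) ≡ Φ b' → Φ b ≡ Δ k ⊎ SimpleReflection b e k
    by-sign (b' , sb≡b') with signedCoeffs b' x (trans (sym sb≡b') sb≡Σx)
    ... | inj₁ (e' , x≡e') = inj₂ (record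
          { root = b' ; coeffs = e' ; reflects = sb≡b'
          ; hasCoeffs = trans (sym sb≡b') (trans sb≡Σx (lincomb-cong Δ x≡e'))
          ; coeffs-off = λ l l≢k → ℕ→ℚ-injective (trans (sym (x≡e' l)) (x-off l l≢k))
          ; coeffs-at = trans (sym (x≡e' k)) x-at })
    ... | inj₂ (e' , x≡-e') = inj₁ (supportedAt⇒simple k b≡Σe
          (λ l l≢k → ℕ→ℚ-≡-neg⇒0 {e l} {e' l} (trans (sym (x-off l l≢k)) (x≡-e' l))))

  height-reflectSimple : ∀ {b e k} (R : SimpleReflection b e k) → 0ℚ < cartan B (Φ b) (Δ k) →
                         height (SimpleReflection.coeffs R) ℕ.< height e
  height-reflectSimple {e = e} {k} R 0<p = height-< e coeffs k coeffs-off (ℕ→ℚ-≡-pos⇒< coeffs-at 0<p)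
    where open SimpleReflection R

  reflectSimple-involutive : ∀ {b e k} (R : SimpleReflection b e k) → reflect B (Δ k) (Φ (SimpleReflection.root R)) ≡ Φ b
  reflectSimple-involutive {b} {k = k} R =
    trans (cong (reflect B (Δ k)) (sym reflects)) (reflect-involutive (Δ k) (Φ b) (∣Φ∣²≢0 (simple k)))
    where open SimpleReflection R

  positive⇒∃simple-⟨⟩>0 : ∀ {b e} → HasCoeffs b e → ∃[ k ] 0ℚ < ⟨ Φ b , Δ k ⟩
  positive⇒∃simple-⟨⟩>0 {b} {e} b≡Σe = by-sign (sum-pos⇒∃pos (λ l → ℕ→ℚ (e l) * ⟨ Δ l , Φ b ⟩) 0<sum)
    where
    0<sum : 0ℚ < sum (λ l → ℕ→ℚ (e l) * ⟨ Δ l , Φ b ⟩)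
    0<sum = subst (0ℚ <_) (trans (cong (λ v → ⟨ v , Φ b ⟩) b≡Σe) (⟨⟩-lincombˡ (ℕ→ℚ ∘ e) Δ (Φ b))) (∣Φ∣²>0 b)
    by-sign : ∃[ k ] 0ℚ < ℕ→ℚ (e k) * ⟨ Δ k , Φ b ⟩ → ∃[ k ] 0ℚ < ⟨ Φ b , Δ k ⟩
    by-sign (k , 0<ek⟨⟩) with 0ℚ <? ⟨ Δ k , Φ b ⟩
    ... | yes 0<⟨⟩ = k , subst (0ℚ <_) (⟨⟩-sym (Δ k) (Φ b)) 0<⟨⟩
    ... | no ⟨⟩≯0 = ⊥-elim (<⇒≱ 0<ek⟨⟩ (nonNeg*nonPos≤0 (ℕ→ℚ-nonNeg (e k)) (≮⇒≥ ⟨⟩≯0)))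

  cartan>0 : ∀ a k → 0ℚ < ⟨ Φ a , Φ k ⟩ → 0ℚ < cartan B (Φ a) (Φ k)
  cartan>0 a k 0<⟨⟩ = ℚP.*-cancelʳ-<-nonNeg ⟨ Φ k , Φ k ⟩ {{ℚ.nonNegative (<⇒≤ (∣Φ∣²>0 k))}}
    (subst₂ _<_ (sym (ℚP.*-zeroˡ ⟨ Φ k , Φ k ⟩)) (sym (cartan-* (Φ a) (Φ k) (∣Φ∣²≢0 k)))
            (*-pos (<-compute 0ℚ (ℕ→ℚ 2)) 0<⟨⟩))

  simple-obtuse : ∀ k l → l ≢ k → ⟨ Δ l , Δ k ⟩ ≤ 0ℚ
  simple-obtuse k l l≢k with 0ℚ <? ⟨ Δ l , Δ k ⟩
  ... | no ⟨⟩≯0 = ≮⇒≥ ⟨⟩≯0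
  ... | yes 0<⟨⟩ with reflectSimple {simple l} {unit l} (simple-hasCoeffs l) k
  ...   | inj₁ Δl≡Δk = ⊥-elim (l≢k (simple-injective l k Δl≡Δk))
  ...   | inj₂ R = ⊥-elim (<⇒≱ coeff<0 (subst (0ℚ ≤_) coeffs-at (ℕ→ℚ-nonNeg (coeffs k))))
    where
    open SimpleReflection R
    c = cartan B (Δ l) (Δ k)
    cancel : ∀ c → 0ℚ - (0ℚ - c) ≡ c
    cancel = solve-∀ ℚ-ring
    coeff<0 : ℕ→ℚ (unit l k) - c < 0ℚ
    coeff<0 rewrite unit-offDiag l k (l≢k ∘ sym) = <-by-diff c (cancel c) (cartan>0 (simple l) (simple k) 0<⟨⟩)

  cartan-short : ∀ s t → ⟨ Φ s , Φ s ⟩ ≡ ℕ→ℚ 2 → cartan B (Φ t) (Φ s) ≡ ⟨ Φ s , Φ t ⟩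
  cartan-short s t ∣s∣²≡2 = *-cancelʳ-≡ (ℕ→ℚ 2) (λ ())
    (trans (subst (λ A → cartan B (Φ t) (Φ s) * A ≡ ℕ→ℚ 2 * ⟨ Φ t , Φ s ⟩) ∣s∣²≡2 (cartan-* (Φ t) (Φ s) (∣Φ∣²≢0 s)))
           (trans (ℚP.*-comm (ℕ→ℚ 2) ⟨ Φ t , Φ s ⟩) (cong (_* ℕ→ℚ 2) (⟨⟩-sym (Φ t) (Φ s)))))

  ⟨short,⟩-integer : ∀ s t → ⟨ Φ s , Φ s ⟩ ≡ ℕ→ℚ 2 → IsInteger ⟨ Φ s , Φ t ⟩
  ⟨short,⟩-integer s t ∣s∣²≡2 = subst IsInteger (cartan-short s t ∣s∣²≡2) (integral s t)

  ∣Φ∣²≤-2⟨⟩ : ∀ s t → ⟨ Φ s , Φ t ⟩ < 0ℚ → ⟨ Φ t , Φ t ⟩ ≤ - (ℕ→ℚ 2 * ⟨ Φ s , Φ t ⟩)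
  ∣Φ∣²≤-2⟨⟩ s t = integer-c*L≡2q⇒L≤-2q (integral t s) (cartan-* (Φ s) (Φ t) (∣Φ∣²≢0 t)) (∣Φ∣²>0 t)

  roots-cauchySchwarz : ∀ a b → (Φ a ≡ Φ b ⊎ Φ a ≡ (- 1ℚ) • Φ b) ⊎
                        ⟨ Φ a , Φ b ⟩ * ⟨ Φ a , Φ b ⟩ < ⟨ Φ a , Φ a ⟩ * ⟨ Φ b , Φ b ⟩
  roots-cauchySchwarz a b with cauchySchwarz-strict (Φ a) (Φ b) (nonzero b)
  ... | inj₂ strict = inj₂ strict
  ... | inj₁ a≡cb with red b a (⟨ Φ a , Φ b ⟩ ÷' ⟨ Φ b , Φ b ⟩) a≡cb
  ...   | inj₁ c≡1 = inj₁ (inj₁ (trans a≡cb (trans (cong (_• Φ b) c≡1) (1•-identity (Φ b)))))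
  ...   | inj₂ c≡-1 = inj₁ (inj₂ (trans a≡cb (cong (_• Φ b) c≡-1)))

  shortPairing : (∀ k → ℕ→ℚ 2 ≤ ⟨ Φ k , Φ k ⟩) → ∀ s t → ⟨ Φ s , Φ s ⟩ ≡ ℕ→ℚ 2 →
    ⟨ Φ s , Φ t ⟩ * ⟨ Φ s , Φ t ⟩ < ⟨ Φ s , Φ s ⟩ * ⟨ Φ t , Φ t ⟩ → ⟨ Φ s , Φ t ⟩ < 0ℚ →
    ⟨ Φ t , Φ t ⟩ ≡ - (ℕ→ℚ 2 * ⟨ Φ s , Φ t ⟩) ×
    (⟨ Φ s , Φ t ⟩ ≡ - 1ℚ ⊎ ⟨ Φ s , Φ t ⟩ ≡ - ℕ→ℚ 2 ⊎ ⟨ Φ s , Φ t ⟩ ≡ - ℕ→ℚ 3)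
  shortPairing 2≤∣Φ∣² s t ∣s∣²≡2 cs =
    shortPairing-numeric (⟨short,⟩-integer s t ∣s∣²≡2) (integral t s) (cartan-* (Φ s) (Φ t) (∣Φ∣²≢0 t))
      (2≤∣Φ∣² t) (subst (λ A → ⟨ Φ s , Φ t ⟩ * ⟨ Φ s , Φ t ⟩ < A * ⟨ Φ t , Φ t ⟩) ∣s∣²≡2 cs)

  shortPairing⁺ : (∀ k → ℕ→ℚ 2 ≤ ⟨ Φ k , Φ k ⟩) → ∀ s t → ⟨ Φ s , Φ s ⟩ ≡ ℕ→ℚ 2 →
    ⟨ Φ s , Φ t ⟩ * ⟨ Φ s , Φ t ⟩ < ⟨ Φ s , Φ s ⟩ * ⟨ Φ t , Φ t ⟩ → 0ℚ < ⟨ Φ s , Φ t ⟩ →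
    ⟨ Φ t , Φ t ⟩ ≡ ℕ→ℚ 2 * ⟨ Φ s , Φ t ⟩
  shortPairing⁺ 2≤∣Φ∣² s t ∣s∣²≡2 cs =
    shortPairing-numeric⁺ (⟨short,⟩-integer s t ∣s∣²≡2) (integral t s) (cartan-* (Φ s) (Φ t) (∣Φ∣²≢0 t))
      (2≤∣Φ∣² t) (subst (λ A → ⟨ Φ s , Φ t ⟩ * ⟨ Φ s , Φ t ⟩ < A * ⟨ Φ t , Φ t ⟩) ∣s∣²≡2 cs)

  height-induction : (P : Fin m → (Fin r → ℕ) → Set) →
    (∀ b e → HasCoeffs b e → (∀ b' e' → HasCoeffs b' e' → height e' ℕ.< height e → P b' e') → P b e) →
    ∀ b e → HasCoeffs b e → P b e
  height-induction P step b e = go (height e) b e refl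
    where
    AtHeight : ℕ → Set
    AtHeight h = ∀ b e → height e ≡ h → HasCoeffs b e → P b e
    go : ∀ h → AtHeight h
    go = <-rec AtHeight λ { h IH b e refl b≡Σe → step b e b≡Σe (λ b' e' b'≡Σe' e'<e → IH e'<e b' e' refl b'≡Σe') }

  negativeRoot : ∀ b → ∃[ b⁻ ] Φ b⁻ ≡ 𝟎 ⊖ Φ b
  negativeRoot b with reflClosed b b
  ... | b⁻ , sb≡b⁻ = b⁻ , trans (sym sb≡b⁻) (reflect-self (Φ b) (∣Φ∣²≢0 b))

  rootCoeffs : Fin m → Fin r → ℚ
  rootCoeffs b with posOrNeg b
  ... | inj₁ (e , _) = ℕ→ℚ ∘ e
  ... | inj₂ (e , _) = λ l → - ℕ→ℚ (e l)

  Φ≡lincomb-rootCoeffs : ∀ b → Φ b ≡ lincomb (rootCoeffs b) Δ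
  Φ≡lincomb-rootCoeffs b with posOrNeg b
  ... | inj₁ (e , b≡Σe) = b≡Σe
  ... | inj₂ (e , -b≡Σe) = trans (sym (𝟎⊖-involutive (Φ b))) (trans (cong (𝟎 ⊖_) -b≡Σe) (𝟎⊖lincomb (ℕ→ℚ ∘ e) Δ))

  rootCoeffs-simple : ∀ k l → rootCoeffs (simple k) l ≡ ℕ→ℚ (unit k l)
  rootCoeffs-simple k = coeffs-unique (rootCoeffs (simple k)) (ℕ→ℚ ∘ unit k)
    (trans (sym (Φ≡lincomb-rootCoeffs (simple k))) (simple-hasCoeffs k))

  module SplitBase (S : Fin r → Bool) (S⊥ : ∀ k l → S k ≡ true → S l ≡ false → ⟨ Δ k , Δ l ⟩ ≡ 0ℚ) where

    VanishesOn : Bool → (Fin r → ℚ) → Set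
    VanishesOn s x = ∀ l → S l ≡ s → x l ≡ 0ℚ

    OneSided : (Fin r → ℚ) → Set
    OneSided x = Σ Bool λ s → VanishesOn s x

    ⊥-across : ∀ k l → S k ≢ S l → ⟨ Δ k , Δ l ⟩ ≡ 0ℚ
    ⊥-across k l Sk≢Sl with S k in Sk | S l in Sl
    ... | true  | false = S⊥ k l Sk Sl
    ... | false | true  = trans (⟨⟩-sym (Δ k) (Δ l)) (S⊥ l k Sl Sk)
    ... | true  | true  = ⊥-elim (Sk≢Sl refl)
    ... | false | false = ⊥-elim (Sk≢Sl refl)

    lincomb-⊥ : ∀ x s k → VanishesOn s x → S k ≡ s → ⟨ lincomb x Δ , Δ k ⟩ ≡ 0ℚ
    lincomb-⊥ x s k x∣s≡0 Sk≡s = ⟨lincomb,⟩≡0 x Δ (Δ k) (λ l → by-side l (S l Data.Bool.≟ s))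
      where by-side : ∀ l → Dec (S l ≡ s) → x l ≡ 0ℚ ⊎ ⟨ Δ l , Δ k ⟩ ≡ 0ℚ
            by-side l (yes Sl≡s) = inj₁ (x∣s≡0 l Sl≡s)
            by-side l (no Sl≢s) = inj₂ (⊥-across l k (λ Sl≡Sk → Sl≢s (trans Sl≡Sk Sk≡s)))

    simple-oneSided : ∀ {b e} k → HasCoeffs b e → Φ b ≡ Δ k → OneSided (ℕ→ℚ ∘ e)
    simple-oneSided {b} {e} k b≡Σe b≡αk = not (S k) , λ l Sl≡¬Sk →
      trans (coeffs-unique (ℕ→ℚ ∘ e) (ℕ→ℚ ∘ unit k) (trans (sym b≡Σe) (trans b≡αk (simple-hasCoeffs k))) l)
            (cong ℕ→ℚ (unit-offDiag k l (λ { refl → BoolP.not-¬ refl Sl≡¬Sk })))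

    -- If s_k b lay on the side of α_k it would be orthogonal to α_k, but ⟨s_k b, α_k⟩ = -⟨b, α_k⟩ < 0.
    reflection-oneSided : ∀ {b e k} → 0ℚ < ⟨ Φ b , Δ k ⟩ → (R : SimpleReflection b e k) →
                          OneSided (ℕ→ℚ ∘ SimpleReflection.coeffs R) → OneSided (ℕ→ℚ ∘ e)
    reflection-oneSided {b} {e} {k} 0<⟨b,αk⟩ R (s , coeffs∣s≡0) with S k Data.Bool.≟ s
    ... | no Sk≢s = s , λ l Sl≡s →
            trans (cong ℕ→ℚ (sym (coeffs-off l λ { refl → Sk≢s Sl≡s }))) (coeffs∣s≡0 l Sl≡s)
      where open SimpleReflection R
    ... | yes Sk≡s = ⊥-elim (<-irrefl ⟨sb,αk⟩≡0 ⟨sb,αk⟩<0)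
      where
      open SimpleReflection R
      ⟨sb,αk⟩≡0 : ⟨ reflect B (Δ k) (Φ b) , Δ k ⟩ ≡ 0ℚ
      ⟨sb,αk⟩≡0 = trans (cong (λ v → ⟨ v , Δ k ⟩) (trans reflects hasCoeffs))
                        (lincomb-⊥ (ℕ→ℚ ∘ coeffs) s k coeffs∣s≡0 Sk≡s)
      ⟨sb,αk⟩<0 : ⟨ reflect B (Δ k) (Φ b) , Δ k ⟩ < 0ℚ
      ⟨sb,αk⟩<0 = subst (_< 0ℚ) (sym (reflect-self-⟨⟩ (Δ k) (Φ b) (∣Φ∣²≢0 (simple k)))) (ℚP.neg-antimono-< 0<⟨b,αk⟩)

    positive-oneSided : ∀ b e → HasCoeffs b e → OneSided (ℕ→ℚ ∘ e)
    positive-oneSided = height-induction (λ _ e → OneSided (ℕ→ℚ ∘ e)) step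
      where
      step : ∀ b e → HasCoeffs b e → (∀ b' e' → HasCoeffs b' e' → height e' ℕ.< height e → OneSided (ℕ→ℚ ∘ e')) →
             OneSided (ℕ→ℚ ∘ e)
      step b e b≡Σe IH with positive⇒∃simple-⟨⟩>0 {b} {e} b≡Σe
      ... | k , 0<⟨b,αk⟩ with reflectSimple {b} {e} b≡Σe k
      ...   | inj₁ b≡αk = simple-oneSided {b} {e} k b≡Σe b≡αk
      ...   | inj₂ R = reflection-oneSided {b} {e} {k} 0<⟨b,αk⟩ R
                (IH (SimpleReflection.root R) (SimpleReflection.coeffs R) (SimpleReflection.hasCoeffs R) (height-reflectSimple R (cartan>0 b (simple k) 0<⟨b,αk⟩)))

    root-oneSided : ∀ b → OneSided (rootCoeffs b)
    root-oneSided b with posOrNeg b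
    ... | inj₁ (e , b≡Σe) = positive-oneSided b e b≡Σe
    ... | inj₂ (e , -b≡Σe) = negated (positive-oneSided (proj₁ (negativeRoot b)) e (trans (proj₂ (negativeRoot b)) -b≡Σe))
      where negated : OneSided (ℕ→ℚ ∘ e) → OneSided (λ l → - ℕ→ℚ (e l))
            negated (s , e∣s≡0) = s , λ l Sl≡s → p≡0⇒-p≡0 (e∣s≡0 l Sl≡s)

    spanned? : ∀ b → Dec (VanishesOn false (rootCoeffs b))
    spanned? b = Dec.map′ (λ h l Sl≡false → by-cases l (h l) Sl≡false) (λ h l → by-decision l (h l))
                   (FinP.all? (λ l → (S l Data.Bool.≟ true) Dec.⊎-dec (rootCoeffs b l ≟ 0ℚ)))
      where
      by-cases : ∀ l → S l ≡ true ⊎ rootCoeffs b l ≡ 0ℚ → S l ≡ false → rootCoeffs b l ≡ 0ℚ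
      by-cases l (inj₁ Sl≡true) Sl≡false = ⊥-elim (BoolP.not-¬ Sl≡true Sl≡false)
      by-cases l (inj₂ c≡0) _ = c≡0
      by-decision : ∀ l → (S l ≡ false → rootCoeffs b l ≡ 0ℚ) → S l ≡ true ⊎ rootCoeffs b l ≡ 0ℚ
      by-decision l h with S l
      ... | true = inj₁ refl
      ... | false = inj₂ (h refl)

    ⊥-spanned : ∀ b b' → VanishesOn false (rootCoeffs b) → ¬ VanishesOn false (rootCoeffs b') → ⟨ Φ b , Φ b' ⟩ ≡ 0ℚ
    ⊥-spanned b b' b∣false≡0 b'-outside with root-oneSided b'
    ... | false , b'∣false≡0 = ⊥-elim (b'-outside b'∣false≡0)
    ... | true , b'∣true≡0 = trans (cong (λ v → ⟨ v , Φ b' ⟩) (Φ≡lincomb-rootCoeffs b))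
                                   (⟨lincomb,⟩≡0 (rootCoeffs b) Δ (Φ b') by-side)
      where
      by-side : ∀ l → rootCoeffs b l ≡ 0ℚ ⊎ ⟨ Δ l , Φ b' ⟩ ≡ 0ℚ
      by-side l with S l in Sl
      ... | false = inj₁ (b∣false≡0 l Sl)
      ... | true = inj₂ (trans (⟨⟩-sym (Δ l) (Φ b'))
                     (trans (cong (λ v → ⟨ v , Δ l ⟩) (Φ≡lincomb-rootCoeffs b')) (lincomb-⊥ (rootCoeffs b') true l b'∣true≡0 Sl)))

    simple-spanned⇒true : ∀ l → VanishesOn false (rootCoeffs (simple l)) → S l ≡ true
    simple-spanned⇒true l αl∣false≡0 with S l in Sl
    ... | true = refl
    ... | false = ⊥-elim (ℚP.1≢0 (trans (sym (trans (rootCoeffs-simple l l) (cong ℕ→ℚ (unit-diag l)))) (αl∣false≡0 l Sl)))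

    true⇒simple-spanned : ∀ l → S l ≡ true → VanishesOn false (rootCoeffs (simple l))
    true⇒simple-spanned l Sl≡true l' Sl'≡false =
      trans (rootCoeffs-simple l l') (cong ℕ→ℚ (unit-offDiag l l' λ { refl → BoolP.not-¬ Sl≡true Sl'≡false }))

  irreducible⇒connected : Irreducible B Φ → (S : Fin r → Bool) →
    (∀ k l → S k ≡ true → S l ≡ false → ⟨ Δ k , Δ l ⟩ ≡ 0ℚ) → (∀ l → S l ≡ true) ⊎ (∀ l → S l ≡ false)
  irreducible⇒connected irr S S⊥ with irr (does ∘ spanned?) (λ b b' in-b out-b' →
                                        ⊥-spanned b b' (does≡true⇒ (spanned? b) in-b) (does≡false⇒ (spanned? b') out-b'))
    where open SplitBase S S⊥
  ... | inj₁ all-in = inj₁ (λ l → simple-spanned⇒true l (does≡true⇒ (spanned? (simple l)) (all-in (simple l))))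
    where open SplitBase S S⊥
  ... | inj₂ all-out = inj₂ (λ l → BoolP.¬-not (does≡false⇒ (spanned? (simple l)) (all-out (simple l)) ∘ true⇒simple-spanned l))
    where open SplitBase S S⊥

covered-by-two⇒≡2 : ∀ {r} (i k : Fin r) → i ≢ k → (∀ l → l ≡ i ⊎ l ≡ k) → r ≡ 2
covered-by-two⇒≡2 {r} i k i≢k covered =
  ℕP.≤-antisym (FinP.injective⇒≤ {f = side} side-injective) (FinP.injective⇒≤ {f = pair} pair-injective)
  where
  side : Fin r → Fin 2
  side l with l Fin.≟ i
  ... | yes _ = zero
  ... | no _ = suc zero
  ≢i⇒≡k : ∀ l → l ≢ i → l ≡ k
  ≢i⇒≡k l l≢i with covered l
  ... | inj₁ l≡i = ⊥-elim (l≢i l≡i)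
  ... | inj₂ l≡k = l≡k
  side-injective : ∀ {x y} → side x ≡ side y → x ≡ y
  side-injective {x} {y} eq with x Fin.≟ i | y Fin.≟ i
  side-injective {x} {y} eq | yes x≡i | yes y≡i = trans x≡i (sym y≡i)
  side-injective {x} {y} () | yes _ | no _
  side-injective {x} {y} () | no _ | yes _
  side-injective {x} {y} eq | no x≢i | no y≢i = trans (≢i⇒≡k x x≢i) (sym (≢i⇒≡k y y≢i))
  pair : Fin 2 → Fin r
  pair zero = i
  pair (suc zero) = k
  pair-injective : ∀ {x y} → pair x ≡ pair y → x ≡ y
  pair-injective {zero} {zero} _ = refl
  pair-injective {zero} {suc zero} i≡k = ⊥-elim (i≢k i≡k)
  pair-injective {suc zero} {zero} k≡i = ⊥-elim (i≢k (sym k≡i))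
  pair-injective {suc zero} {suc zero} _ = refl

module TripleBond {n m r : ℕ} (B : Gram n) (Φ : Fin m → V n) (simple : Fin r → Fin m)
                  (RS : IsRootSystem B Φ) (red : Reduced Φ) (base : IsBase Φ simple) (i k : Fin r)
                  (∣αi∣²≡2 : ⟪ B ⟫ (Φ (simple i)) (Φ (simple i)) ≡ ℕ→ℚ 2)
                  (⟨αi,αk⟩≡-3 : ⟪ B ⟫ (Φ (simple i)) (Φ (simple k)) ≡ - ℕ→ℚ 3)
                  (∣αk∣²≡6 : ⟪ B ⟫ (Φ (simple k)) (Φ (simple k)) ≡ ℕ→ℚ 6) where

  open RootSystem B Φ simple RS red base

  i≢k : i ≢ k
  i≢k refl = 2≢-3 (trans (sym ∣αi∣²≡2) ⟨αi,αk⟩≡-3)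
    where 2≢-3 : ℕ→ℚ 2 ≢ - ℕ→ℚ 3
          2≢-3 ()

  combination≢𝟎 : ∀ a b l → l ≢ i → a ≢ 0ℚ → ((a • Δ i) ⊕ (b • Δ k)) ⊕ Δ l ≢ 𝟎
  combination≢𝟎 a b l l≢i a≢0 X≡𝟎 =
    a≢0 (trans (sym coeff-i) (coeffs-unique c (λ _ → 0ℚ) (trans (sym X≡Σc) (trans X≡𝟎 (sym (lincomb-zero Δ)))) i))
    where
    c : Fin r → ℚ
    c l' = (a * ℕ→ℚ (unit i l') + b * ℕ→ℚ (unit k l')) + ℕ→ℚ (unit l l')
    X≡Σc : ((a • Δ i) ⊕ (b • Δ k)) ⊕ Δ l ≡ lincomb c Δ
    X≡Σc = trans (cong₂ _⊕_ (cong₂ _⊕_ (trans (cong (a •_) (simple-hasCoeffs i)) (lincomb-• a (ℕ→ℚ ∘ unit i) Δ))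
                                        (trans (cong (b •_) (simple-hasCoeffs k)) (lincomb-• b (ℕ→ℚ ∘ unit k) Δ)))
                            (simple-hasCoeffs l))
             (trans (cong (_⊕ lincomb (ℕ→ℚ ∘ unit l) Δ) (lincomb-⊕ (λ l' → a * ℕ→ℚ (unit i l')) (λ l' → b * ℕ→ℚ (unit k l')) Δ))
                    (lincomb-⊕ (λ l' → a * ℕ→ℚ (unit i l') + b * ℕ→ℚ (unit k l')) (ℕ→ℚ ∘ unit l) Δ))
    coeff-i : (a * ℕ→ℚ (unit i i) + b * ℕ→ℚ (unit k i)) + ℕ→ℚ (unit l i) ≡ a
    coeff-i rewrite unit-diag i | unit-offDiag k i i≢k | unit-offDiag l i (l≢i ∘ sym) = cancel a b
      where cancel : ∀ a b → (a * 1ℚ + b * 0ℚ) + 0ℚ ≡ a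
            cancel = solve-∀ ℚ-ring

  ∣aαi+bαk+αl∣² : ∀ a b l → ⟨ ((a • Δ i) ⊕ (b • Δ k)) ⊕ Δ l , ((a • Δ i) ⊕ (b • Δ k)) ⊕ Δ l ⟩ ≡
    ((a * a * ℕ→ℚ 2 + b * b * ℕ→ℚ 6) + ⟨ Δ l , Δ l ⟩) +
    ((ℕ→ℚ 2 * a * b * - ℕ→ℚ 3 + ℕ→ℚ 2 * a * ⟨ Δ i , Δ l ⟩) + ℕ→ℚ 2 * b * ⟨ Δ k , Δ l ⟩)
  ∣aαi+bαk+αl∣² a b l rewrite ⟨⟩-expand₃ a b (Δ i) (Δ k) (Δ l) | ∣αi∣²≡2 | ∣αk∣²≡6 | ⟨αi,αk⟩≡-3 = refl

  -- Otherwise 2α_i + α_k + α_l would have squared length ≤ 0.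
  ⟨αi,αl⟩≡0 : ∀ l → l ≢ i → l ≢ k → ⟨ Δ i , Δ l ⟩ ≡ 0ℚ
  ⟨αi,αl⟩≡0 l l≢i l≢k = ≤-antisym (subst (_≤ 0ℚ) (⟨⟩-sym (Δ l) (Δ i)) (simple-obtuse i l l≢i)) (≮⇒≥ s≮0)
    where
    s = ⟨ Δ i , Δ l ⟩
    t = ⟨ Δ k , Δ l ⟩
    M = ⟨ Δ l , Δ l ⟩
    rearrange : ∀ s t M →
      0ℚ - (((ℕ→ℚ 2 * ℕ→ℚ 2 * ℕ→ℚ 2 + 1ℚ * 1ℚ * ℕ→ℚ 6) + M) + ((ℕ→ℚ 2 * ℕ→ℚ 2 * 1ℚ * - ℕ→ℚ 3 + ℕ→ℚ 2 * ℕ→ℚ 2 * s) + ℕ→ℚ 2 * 1ℚ * t))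
      ≡ ((- (ℕ→ℚ 2 * s) - M) + ℕ→ℚ 2 * (- 1ℚ - s)) + ℕ→ℚ 2 * (0ℚ - t)
    rearrange = solve-∀ ℚ-ring
    s≮0 : ¬ (s < 0ℚ)
    s≮0 s<0 = <⇒≱ (⟨⟩-posDef _ (combination≢𝟎 (ℕ→ℚ 2) 1ℚ l l≢i (λ ())))
      (≤-by-diff _ (trans (cong (λ v → 0ℚ - v) (∣aαi+bαk+αl∣² (ℕ→ℚ 2) 1ℚ l)) (rearrange s t M))
        (+-nonNeg (+-nonNeg (p≤q⇒0≤q-p (∣Φ∣²≤-2⟨⟩ (simple i) (simple l) s<0))
                            (*-nonNeg (≤-compute 0ℚ (ℕ→ℚ 2))
                                      (p≤q⇒0≤q-p (integer<0⇒≤-1 (⟨short,⟩-integer (simple i) (simple l) ∣αi∣²≡2) s<0))))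
                  (*-nonNeg (≤-compute 0ℚ (ℕ→ℚ 2)) (p≤q⇒0≤q-p (subst (_≤ 0ℚ) (⟨⟩-sym (Δ l) (Δ k)) (simple-obtuse k l l≢k))))))

  -- Otherwise 3α_i + 2α_k + α_l would have squared length ≤ 0.
  ⟨αk,αl⟩≡0 : ∀ l → l ≢ i → l ≢ k → ⟨ Δ k , Δ l ⟩ ≡ 0ℚ
  ⟨αk,αl⟩≡0 l l≢i l≢k = ≤-antisym (subst (_≤ 0ℚ) (⟨⟩-sym (Δ l) (Δ k)) (simple-obtuse k l l≢k)) (≮⇒≥ t≮0)
    where
    t = ⟨ Δ k , Δ l ⟩
    M = ⟨ Δ l , Δ l ⟩
    rearrange : ∀ t M s → s ≡ 0ℚ →
      0ℚ - (((ℕ→ℚ 3 * ℕ→ℚ 3 * ℕ→ℚ 2 + ℕ→ℚ 2 * ℕ→ℚ 2 * ℕ→ℚ 6) + M) + ((ℕ→ℚ 2 * ℕ→ℚ 3 * ℕ→ℚ 2 * - ℕ→ℚ 3 + ℕ→ℚ 2 * ℕ→ℚ 3 * s) + ℕ→ℚ 2 * ℕ→ℚ 2 * t))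
      ≡ (- (ℕ→ℚ 2 * t) - M) + (- (ℕ→ℚ 2 * t) - ℕ→ℚ 6)
    rearrange t M s refl = identity t M
      where identity : ∀ t M →
              0ℚ - (((ℕ→ℚ 3 * ℕ→ℚ 3 * ℕ→ℚ 2 + ℕ→ℚ 2 * ℕ→ℚ 2 * ℕ→ℚ 6) + M) + ((ℕ→ℚ 2 * ℕ→ℚ 3 * ℕ→ℚ 2 * - ℕ→ℚ 3 + ℕ→ℚ 2 * ℕ→ℚ 3 * 0ℚ) + ℕ→ℚ 2 * ℕ→ℚ 2 * t))
              ≡ (- (ℕ→ℚ 2 * t) - M) + (- (ℕ→ℚ 2 * t) - ℕ→ℚ 6)
            identity = solve-∀ ℚ-ring
    t≮0 : ¬ (t < 0ℚ)
    t≮0 t<0 = <⇒≱ (⟨⟩-posDef _ (combination≢𝟎 (ℕ→ℚ 3) (ℕ→ℚ 2) l l≢i (λ ())))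
      (≤-by-diff _ (trans (cong (λ v → 0ℚ - v) (∣aαi+bαk+αl∣² (ℕ→ℚ 3) (ℕ→ℚ 2) l)) (rearrange t M _ (⟨αi,αl⟩≡0 l l≢i l≢k)))
        (+-nonNeg (p≤q⇒0≤q-p (∣Φ∣²≤-2⟨⟩ (simple k) (simple l) t<0)) (p≤q⇒0≤q-p 6≤-2t)))
      where
      6≤-2t : ℕ→ℚ 6 ≤ - (ℕ→ℚ 2 * t)
      6≤-2t = subst₂ (λ L x → L ≤ - (ℕ→ℚ 2 * x)) ∣αk∣²≡6 (⟨⟩-sym (Δ l) (Δ k))
                (∣Φ∣²≤-2⟨⟩ (simple l) (simple k) (subst (_< 0ℚ) (⟨⟩-sym (Δ k) (Δ l)) t<0))

  inPair? : ∀ l → Dec (l ≡ i ⊎ l ≡ k)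
  inPair? l = (l Fin.≟ i) Dec.⊎-dec (l Fin.≟ k)

  pair⊥others : ∀ a b → does (inPair? a) ≡ true → does (inPair? b) ≡ false → ⟨ Δ a , Δ b ⟩ ≡ 0ℚ
  pair⊥others a b a-in b-out with does≡true⇒ (inPair? a) a-in
  ... | inj₁ refl = ⟨αi,αl⟩≡0 b (does≡false⇒ (inPair? b) b-out ∘ inj₁) (does≡false⇒ (inPair? b) b-out ∘ inj₂)
  ... | inj₂ refl = ⟨αk,αl⟩≡0 b (does≡false⇒ (inPair? b) b-out ∘ inj₁) (does≡false⇒ (inPair? b) b-out ∘ inj₂)

  tripleBond⇒G₂ : Irreducible B Φ → TypeG₂ B Φ simple
  tripleBond⇒G₂ irr = covered-by-two⇒≡2 i k i≢k covered , i , k , cartan-product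
    where
    covered : ∀ l → l ≡ i ⊎ l ≡ k
    covered with irreducible⇒connected irr (does ∘ inPair?) pair⊥others
    ... | inj₁ all-in = λ l → does≡true⇒ (inPair? l) (all-in l)
    ... | inj₂ all-out = ⊥-elim (does≡false⇒ (inPair? i) (all-out i) (inj₁ refl))
    cartan-product : cartan B (Δ i) (Δ k) * cartan B (Δ k) (Δ i) ≡ ℕ→ℚ 3
    cartan-product = cong₂ _*_ (cong₂ (λ x L → (ℕ→ℚ 2 * x) ÷' L) ⟨αi,αk⟩≡-3 ∣αk∣²≡6)
                               (cong₂ (λ x L → (ℕ→ℚ 2 * x) ÷' L) (trans (⟨⟩-sym (Δ k) (Δ i)) ⟨αi,αk⟩≡-3) ∣αi∣²≡2)

module StabiliserOrbit {n m r : ℕ} (B : Gram n) (Φ : Fin m → V n) (simple : Fin r → Fin m)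
                       (RS : IsRootSystem B Φ) (red : Reduced Φ) (base : IsBase Φ simple)
                       (2≤∣Φ∣² : ∀ k → ℕ→ℚ 2 ≤ ⟪ B ⟫ (Φ k) (Φ k))
                       (i : Fin r) (∣αi∣²≡2 : ⟪ B ⟫ (Φ (simple i)) (Φ (simple i)) ≡ ℕ→ℚ 2)
                       (noTripleBond : ∀ k → ⟪ B ⟫ (Φ (simple i)) (Φ (simple k)) ≡ - ℕ→ℚ 3 →
                                             ⟪ B ⟫ (Φ (simple k)) (Φ (simple k)) ≡ ℕ→ℚ 6 → ⊥) where

  open RootSystem B Φ simple RS red base

  InStabiliserOrbit : Fin m → Set
  InStabiliserOrbit a = ∃[ j ] (⟨ Δ i , Δ j ⟩ ≡ - 1ℚ × ∃[ w ] (act B Φ w (Δ i) ≡ Δ i × act B Φ w (Δ j) ≡ Φ a))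

  InStabiliserOrbit-transport : ∀ {a b} w₀ → act B Φ w₀ (Δ i) ≡ Δ i → act B Φ w₀ (Φ b) ≡ Φ a →
                                InStabiliserOrbit b → InStabiliserOrbit a
  InStabiliserOrbit-transport w₀ w₀αi≡αi w₀b≡a (j , ⟨αi,αj⟩≡-1 , w , wαi≡αi , wαj≡b) =
    j , ⟨αi,αj⟩≡-1 , w₀ ++ w ,
    trans (act-++ (Δ i)) (trans (cong (act B Φ w₀) wαi≡αi) w₀αi≡αi) ,
    trans (act-++ (Δ j)) (trans (cong (act B Φ w₀) wαj≡b) w₀b≡a)
    where act-++ : ∀ v → act B Φ (w₀ ++ w) v ≡ act B Φ w₀ (act B Φ w v)
          act-++ v = ListP.foldr-++ (λ k u → reflect B (Φ k) u) v w₀ w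

  Below : (Fin r → ℕ) → Set
  Below e = ∀ b e' → HasCoeffs b e' → height e' ℕ.< height e → ⟨ Δ i , Φ b ⟩ ≡ - 1ℚ → InStabiliserOrbit b

  ⟨αi,a⟩≡-1⇒∣a∣²≡2 : ∀ a → ⟨ Δ i , Φ a ⟩ ≡ - 1ℚ → ⟨ Φ a , Φ a ⟩ ≡ ℕ→ℚ 2
  ⟨αi,a⟩≡-1⇒∣a∣²≡2 a h =
    ≤-antisym (subst (λ q → ⟨ Φ a , Φ a ⟩ ≤ - (ℕ→ℚ 2 * q)) h
                     (∣Φ∣²≤-2⟨⟩ (simple i) a (subst (_< 0ℚ) (sym h) (<-compute (- 1ℚ) 0ℚ))))
              (2≤∣Φ∣² a)

  ⟨a,αk⟩>0⇒k≢i : ∀ {a k} → ⟨ Δ i , Φ a ⟩ ≡ - 1ℚ → 0ℚ < ⟨ Φ a , Δ k ⟩ → k ≢ i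
  ⟨a,αk⟩>0⇒k≢i {a} h 0<⟨a,αk⟩ refl =
    <⇒≱ 0<⟨a,αk⟩ (subst (_≤ 0ℚ) (trans (sym h) (⟨⟩-sym (Δ i) (Φ a))) (≤-compute (- 1ℚ) 0ℚ))

  orthogonal-case : ∀ {a e k} → Below e → ⟨ Δ i , Φ a ⟩ ≡ - 1ℚ → 0ℚ < ⟨ Φ a , Δ k ⟩ →
                    (R : SimpleReflection a e k) → ⟨ Δ i , Δ k ⟩ ≡ 0ℚ → InStabiliserOrbit a
  orthogonal-case {a} {e} {k} IH h 0<⟨a,αk⟩ R ⟨αi,αk⟩≡0 =
    InStabiliserOrbit-transport (simple k ∷ []) (reflect-⊥ (Δ k) (Δ i) ⟨αi,αk⟩≡0) (reflectSimple-involutive R)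
      (IH root coeffs hasCoeffs (height-reflectSimple R (cartan>0 a (simple k) 0<⟨a,αk⟩)) ⟨αi,a'⟩≡-1)
    where
    open SimpleReflection R
    cancel : ∀ c → - 1ℚ - c * 0ℚ ≡ - 1ℚ
    cancel = solve-∀ ℚ-ring
    ⟨αi,a'⟩≡-1 : ⟨ Δ i , Φ root ⟩ ≡ - 1ℚ
    ⟨αi,a'⟩≡-1 = trans (cong (λ v → ⟨ Δ i , v ⟩) (sym reflects))
      (trans (reflect-⟨⟩ʳ (Δ k) (Φ a) (Δ i))
        (trans (cong₂ (λ x y → x - cartan B (Φ a) (Δ k) * y) h ⟨αi,αk⟩≡0) (cancel (cartan B (Φ a) (Δ k)))))

  -- a' = s_k a = a - α_k is orthogonal to α_i, and the reflection in a' sends α_k to α_k + a' = a.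
  simpleBond-case : ∀ {a e k} → ⟨ Δ i , Φ a ⟩ ≡ - 1ℚ → (R : SimpleReflection a e k) →
    ⟨ Δ i , Δ k ⟩ ≡ - 1ℚ → ⟨ Δ k , Δ k ⟩ ≡ ℕ→ℚ 2 → ⟨ Φ a , Δ k ⟩ ≡ 1ℚ → InStabiliserOrbit a
  simpleBond-case {a} {e} {k} h R ⟨αi,αk⟩≡-1 ∣αk∣²≡2 ⟨a,αk⟩≡1 =
    k , ⟨αi,αk⟩≡-1 , root ∷ [] , reflect-⊥ (Φ root) (Δ i) ⟨αi,a'⟩≡0 , a'αk≡a
    where
    open SimpleReflection R
    c≡1 : cartan B (Φ a) (Δ k) ≡ 1ℚ
    c≡1 = cong₂ (λ x L → (ℕ→ℚ 2 * x) ÷' L) ⟨a,αk⟩≡1 ∣αk∣²≡2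
    ⟨αi,a'⟩≡0 : ⟨ Δ i , Φ root ⟩ ≡ 0ℚ
    ⟨αi,a'⟩≡0 = trans (cong (λ v → ⟨ Δ i , v ⟩) (sym reflects))
      (trans (reflect-⟨⟩ʳ (Δ k) (Φ a) (Δ i)) (cong₂ (λ x y → x - y) h (cong₂ _*_ c≡1 ⟨αi,αk⟩≡-1)))
    ⟨αk,a'⟩≡-1 : ⟨ Δ k , Φ root ⟩ ≡ - 1ℚ
    ⟨αk,a'⟩≡-1 = trans (⟨⟩-sym (Δ k) (Φ root)) (trans (cong (λ v → ⟨ v , Δ k ⟩) (sym reflects))
      (trans (reflect-self-⟨⟩ (Δ k) (Φ a) (∣Φ∣²≢0 (simple k))) (cong -_ ⟨a,αk⟩≡1)))
    ∣a'∣²≡2 : ⟨ Φ root , Φ root ⟩ ≡ ℕ→ℚ 2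
    ∣a'∣²≡2 = trans (cong₂ ⟨_,_⟩ (sym reflects) (sym reflects))
      (trans (reflect-isometry (Δ k) (Φ a) (Φ a) (∣Φ∣²≢0 (simple k))) (⟨αi,a⟩≡-1⇒∣a∣²≡2 a h))
    a'αk≡a : reflect B (Φ root) (Δ k) ≡ Φ a
    a'αk≡a = begin
      reflect B (Φ root) (Δ k)
        ≡⟨ cong₂ (λ c v → Δ k ⊖ (c • v)) (cong₂ (λ x L → (ℕ→ℚ 2 * x) ÷' L) ⟨αk,a'⟩≡-1 ∣a'∣²≡2) (sym reflects) ⟩
      Δ k ⊖ ((- 1ℚ) • reflect B (Δ k) (Φ a))
        ≡⟨ cong (λ c → Δ k ⊖ ((- 1ℚ) • (Φ a ⊖ (c • Δ k)))) c≡1 ⟩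
      Δ k ⊖ ((- 1ℚ) • (Φ a ⊖ (1ℚ • Δ k)))
        ≡⟨ y⊖-1•[x⊖1•y]≡x (Φ a) (Δ k) ⟩
      Φ a ∎
      where open ≡-Reasoning

  doubleBond-fixes-αi : ∀ {k} → ⟨ Δ i , Δ k ⟩ ≡ - ℕ→ℚ 2 → ⟨ Δ k , Δ k ⟩ ≡ ℕ→ℚ 4 →
                        act B Φ (simple k ∷ simple i ∷ simple k ∷ []) (Δ i) ≡ Δ i
  doubleBond-fixes-αi {k} ⟨αi,αk⟩≡-2 ∣αk∣²≡4 = reflect-conjugate-fix (Δ k) (Δ i) (∣Φ∣²≢0 (simple k))
    (trans (reflect-⟨⟩ˡ (Δ k) (Δ i) (Δ i))
      (cong₂ (λ x y → x - y) ∣αi∣²≡2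
        (cong₂ _*_ (cong₂ (λ x L → (ℕ→ℚ 2 * x) ÷' L) ⟨αi,αk⟩≡-2 ∣αk∣²≡4) (trans (⟨⟩-sym (Δ k) (Δ i)) ⟨αi,αk⟩≡-2))))

  -- a'' = s_i s_k a is orthogonal to α_k, has ⟨α_i, a''⟩ = -1 and lower height; s_k s_i s_k fixes α_i and sends a'' to a.
  doubleBond-case : ∀ {a e k} → Below e → ⟨ Δ i , Φ a ⟩ ≡ - 1ℚ → (R : SimpleReflection a e k) →
    ⟨ Δ i , Δ k ⟩ ≡ - ℕ→ℚ 2 → ⟨ Δ k , Δ k ⟩ ≡ ℕ→ℚ 4 → ⟨ Φ a , Δ k ⟩ ≡ ℕ→ℚ 2 → InStabiliserOrbit a
  doubleBond-case {a} {e} {k} IH h R ⟨αi,αk⟩≡-2 ∣αk∣²≡4 ⟨a,αk⟩≡2 =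
    by-reflection (reflectSimple {root} {coeffs} hasCoeffs i)
    where
    open SimpleReflection R
    c≡1 : cartan B (Φ a) (Δ k) ≡ 1ℚ
    c≡1 = cong₂ (λ x L → (ℕ→ℚ 2 * x) ÷' L) ⟨a,αk⟩≡2 ∣αk∣²≡4
    ⟨αi,a'⟩≡1 : ⟨ Δ i , Φ root ⟩ ≡ 1ℚ
    ⟨αi,a'⟩≡1 = trans (cong (λ v → ⟨ Δ i , v ⟩) (sym reflects))
      (trans (reflect-⟨⟩ʳ (Δ k) (Φ a) (Δ i)) (cong₂ (λ x y → x - y) h (cong₂ _*_ c≡1 ⟨αi,αk⟩≡-2)))
    ⟨a',αk⟩≡-2 : ⟨ Φ root , Δ k ⟩ ≡ - ℕ→ℚ 2
    ⟨a',αk⟩≡-2 = trans (cong (λ v → ⟨ v , Δ k ⟩) (sym reflects))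
      (trans (reflect-self-⟨⟩ (Δ k) (Φ a) (∣Φ∣²≢0 (simple k))) (cong -_ ⟨a,αk⟩≡2))
    c'≡1 : cartan B (Φ root) (Δ i) ≡ 1ℚ
    c'≡1 = trans (cartan-short (simple i) root ∣αi∣²≡2) ⟨αi,a'⟩≡1
    by-reflection : Φ root ≡ Δ i ⊎ SimpleReflection root coeffs i → InStabiliserOrbit a
    by-reflection (inj₁ a'≡αi) = ⊥-elim (1≢2 (trans (sym ⟨αi,a'⟩≡1) (trans (cong (λ v → ⟨ Δ i , v ⟩) a'≡αi) ∣αi∣²≡2)))
      where 1≢2 : 1ℚ ≢ ℕ→ℚ 2
            1≢2 ()
    by-reflection (inj₂ R') = InStabiliserOrbit-transport (simple k ∷ simple i ∷ simple k ∷ []) (doubleBond-fixes-αi ⟨αi,αk⟩≡-2 ∣αk∣²≡4) a''↦a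
      (IH a'' e'' hasCoeffs'' (ℕP.<-trans (height-reflectSimple R' 0<c') (height-reflectSimple R 0<c)) ⟨αi,a''⟩≡-1)
      where
      open SimpleReflection R' using () renaming (root to a''; coeffs to e''; hasCoeffs to hasCoeffs''; reflects to reflects')
      0<c : 0ℚ < cartan B (Φ a) (Δ k)
      0<c = subst (0ℚ <_) (sym c≡1) (<-compute 0ℚ 1ℚ)
      0<c' : 0ℚ < cartan B (Φ root) (Δ i)
      0<c' = subst (0ℚ <_) (sym c'≡1) (<-compute 0ℚ 1ℚ)
      ⟨αi,a''⟩≡-1 : ⟨ Δ i , Φ a'' ⟩ ≡ - 1ℚ
      ⟨αi,a''⟩≡-1 = trans (cong (λ v → ⟨ Δ i , v ⟩) (sym reflects'))
        (trans (reflect-⟨⟩ʳ (Δ i) (Φ root) (Δ i)) (cong₂ (λ x y → x - y) ⟨αi,a'⟩≡1 (cong₂ _*_ c'≡1 ∣αi∣²≡2)))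
      ⟨a'',αk⟩≡0 : ⟨ Φ a'' , Δ k ⟩ ≡ 0ℚ
      ⟨a'',αk⟩≡0 = trans (cong (λ v → ⟨ v , Δ k ⟩) (sym reflects'))
        (trans (reflect-⟨⟩ˡ (Δ i) (Φ root) (Δ k)) (cong₂ (λ x y → x - y) ⟨a',αk⟩≡-2 (cong₂ _*_ c'≡1 ⟨αi,αk⟩≡-2)))
      a''↦a : reflect B (Δ k) (reflect B (Δ i) (reflect B (Δ k) (Φ a''))) ≡ Φ a
      a''↦a = trans (cong (reflect B (Δ k) ∘ reflect B (Δ i)) (reflect-⊥ (Δ k) (Φ a'') ⟨a'',αk⟩≡0))
                (trans (cong (reflect B (Δ k)) (reflectSimple-involutive R')) (reflectSimple-involutive R))

  bonded-case : ∀ {a e k} → Below e → ⟨ Δ i , Φ a ⟩ ≡ - 1ℚ → 0ℚ < ⟨ Φ a , Δ k ⟩ → Φ a ≢ Δ k →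
                (R : SimpleReflection a e k) → ⟨ Δ i , Δ k ⟩ < 0ℚ → InStabiliserOrbit a
  bonded-case {a} {e} {k} IH h 0<⟨a,αk⟩ a≢αk R ⟨αi,αk⟩<0 =
    by-bond (shortPairing 2≤∣Φ∣² (simple i) (simple k) ∣αi∣²≡2 cs-ik ⟨αi,αk⟩<0)
    where
    k≢i = ⟨a,αk⟩>0⇒k≢i h 0<⟨a,αk⟩
    cs-ik : ⟨ Δ i , Δ k ⟩ * ⟨ Δ i , Δ k ⟩ < ⟨ Δ i , Δ i ⟩ * ⟨ Δ k , Δ k ⟩
    cs-ik with roots-cauchySchwarz (simple i) (simple k)
    ... | inj₁ (inj₁ αi≡αk) = ⊥-elim (k≢i (sym (simple-injective i k αi≡αk)))
    ... | inj₁ (inj₂ αi≡-αk) = ⊥-elim (simple-not-multiple i k (- 1ℚ) (k≢i ∘ sym) αi≡-αk)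
    ... | inj₂ cs = cs
    cs-ak : ⟨ Φ a , Δ k ⟩ * ⟨ Φ a , Δ k ⟩ < ⟨ Φ a , Φ a ⟩ * ⟨ Δ k , Δ k ⟩
    cs-ak with roots-cauchySchwarz a (simple k)
    ... | inj₁ (inj₁ a≡αk) = ⊥-elim (a≢αk a≡αk)
    ... | inj₁ (inj₂ a≡-αk) = ⊥-elim (ℚP.<-asym 0<⟨a,αk⟩ (subst (_< 0ℚ)
            (sym (trans (cong (λ v → ⟨ v , Δ k ⟩) a≡-αk) (⟨⟩-•ˡ (- 1ℚ) (Δ k) (Δ k))))
            (ℚP.negative⁻¹ _ {{ℚP.neg*pos⇒neg (- 1ℚ) ⟨ Δ k , Δ k ⟩ {{ℚ.positive (∣Φ∣²>0 (simple k))}}}})))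
    ... | inj₂ cs = cs
    ⟨a,αk⟩≡½L : ⟨ Φ a , Δ k ⟩ ≡ ½ * (1ℚ * ⟨ Δ k , Δ k ⟩)
    ⟨a,αk⟩≡½L = c*L≡2q⇒q≡½cL {⟨ Φ a , Δ k ⟩} {1ℚ} {⟨ Δ k , Δ k ⟩}
      (trans (ℚP.*-identityˡ _) (shortPairing⁺ 2≤∣Φ∣² a (simple k) (⟨αi,a⟩≡-1⇒∣a∣²≡2 a h) cs-ak 0<⟨a,αk⟩))
    by-bond : ⟨ Δ k , Δ k ⟩ ≡ - (ℕ→ℚ 2 * ⟨ Δ i , Δ k ⟩) ×
              (⟨ Δ i , Δ k ⟩ ≡ - 1ℚ ⊎ ⟨ Δ i , Δ k ⟩ ≡ - ℕ→ℚ 2 ⊎ ⟨ Δ i , Δ k ⟩ ≡ - ℕ→ℚ 3) → InStabiliserOrbit a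
    by-bond (L≡-2q , inj₁ q≡-1) = simpleBond-case h R q≡-1 L≡2 (trans ⟨a,αk⟩≡½L (cong (λ L → ½ * (1ℚ * L)) L≡2))
      where L≡2 = trans L≡-2q (cong (λ q → - (ℕ→ℚ 2 * q)) q≡-1)
    by-bond (L≡-2q , inj₂ (inj₁ q≡-2)) = doubleBond-case IH h R q≡-2 L≡4 (trans ⟨a,αk⟩≡½L (cong (λ L → ½ * (1ℚ * L)) L≡4))
      where L≡4 = trans L≡-2q (cong (λ q → - (ℕ→ℚ 2 * q)) q≡-2)
    by-bond (L≡-2q , inj₂ (inj₂ q≡-3)) = ⊥-elim (noTripleBond k q≡-3 (trans L≡-2q (cong (λ q → - (ℕ→ℚ 2 * q)) q≡-3)))

  step : ∀ a e → HasCoeffs a e → Below e → ⟨ Δ i , Φ a ⟩ ≡ - 1ℚ → InStabiliserOrbit a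
  step a e a≡Σe IH h with positive⇒∃simple-⟨⟩>0 {a} {e} a≡Σe
  ... | k , 0<⟨a,αk⟩ with VecP.≡-dec _≟_ (Φ a) (Δ k)
  ...   | yes a≡αk = k , subst (λ v → ⟨ Δ i , v ⟩ ≡ - 1ℚ) a≡αk h , [] , refl , sym a≡αk
  ...   | no a≢αk with reflectSimple {a} {e} a≡Σe k
  ...     | inj₁ a≡αk = ⊥-elim (a≢αk a≡αk)
  ...     | inj₂ R with ℚP.<-cmp ⟨ Δ i , Δ k ⟩ 0ℚ
  ...       | tri< ⟨αi,αk⟩<0 _ _ = bonded-case IH h 0<⟨a,αk⟩ a≢αk R ⟨αi,αk⟩<0
  ...       | tri≈ _ ⟨αi,αk⟩≡0 _ = orthogonal-case IH h 0<⟨a,αk⟩ R ⟨αi,αk⟩≡0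
  ...       | tri> _ _ ⟨αi,αk⟩>0 = ⊥-elim (<⇒≱ ⟨αi,αk⟩>0
                 (subst (_≤ 0ℚ) (⟨⟩-sym (Δ k) (Δ i)) (simple-obtuse i k (⟨a,αk⟩>0⇒k≢i h 0<⟨a,αk⟩))))

  inStabiliserOrbit : ∀ a e → HasCoeffs a e → ⟨ Δ i , Φ a ⟩ ≡ - 1ℚ → InStabiliserOrbit a
  inStabiliserOrbit = height-induction (λ a _ → ⟨ Δ i , Φ a ⟩ ≡ - 1ℚ → InStabiliserOrbit a) step

mainTheorem13 : ∀ {n m r : ℕ} (B : Gram n) (Φ : Fin m → V n) (simple : Fin r → Fin m) →
    IsRootSystem B Φ → Reduced Φ → Irreducible B Φ → IsBase Φ simple →
    ¬ TypeG₂ B Φ simple → ShortNormalized B Φ →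
    ∀ (i : Fin r) → ⟪ B ⟫ (Φ (simple i)) (Φ (simple i)) ≡ ℕ→ℚ 2 →
    ∀ (a : Fin m) → IsPositive (λ k → Φ (simple k)) (Φ a) →
    ⟪ B ⟫ (Φ (simple i)) (Φ a) ≡ - 1ℚ →
    ∃[ j ] (⟪ B ⟫ (Φ (simple i)) (Φ (simple j)) ≡ - 1ℚ ×
      ∃[ w ] (act B Φ w (Φ (simple i)) ≡ Φ (simple i) × act B Φ w (Φ (simple j)) ≡ Φ a))
mainTheorem13 B Φ simple RS red irr base ¬G₂ SN i ∣αi∣²≡2 a (e , a≡Σe) ⟨αi,a⟩≡-1 =
  StabiliserOrbit.inStabiliserOrbit B Φ simple RS red base (proj₁ SN) i ∣αi∣²≡2 noTripleBond a e a≡Σe ⟨αi,a⟩≡-1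
  where
  noTripleBond : ∀ k → ⟪ B ⟫ (Φ (simple i)) (Φ (simple k)) ≡ - ℕ→ℚ 3 → ⟪ B ⟫ (Φ (simple k)) (Φ (simple k)) ≡ ℕ→ℚ 6 → ⊥
  noTripleBond k ⟨αi,αk⟩≡-3 ∣αk∣²≡6 =
    ¬G₂ (TripleBond.tripleBond⇒G₂ B Φ simple RS red base i k ∣αi∣²≡2 ⟨αi,αk⟩≡-3 ∣αk∣²≡6 irr)
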